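{- Let $D$ be the formal derivative with respect to the grammar $G\colon x\to xy,\ y\to xz,\ z\to zw,\ w\to xz$, and let $\mathrm{Gen}(z,t)=\sum_{n\ge0}D^n(z)\,t^n/n!$. Writing $\Delta=\sqrt{(w+y)^2-4xz}$, we have $$\mathrm{Gen}(z,t)=\frac{2z\,\Delta\, e^{\frac{t}{2}(w-y+\Delta)}}{w+y+\Delta-(w+y-\Delta)e^{t\Delta}},$$ as power series in $t$.
   Context: Let $x,y,z,w$ be commuting variables. The formal derivative $D$ is the linear operator on Laurent polynomials in $x,y,z,w$ with $D(uv)=uD(v)+vD(u)$, $D(c)=0$ for constants $c$, and $D(x)=xy$, $D(y)=xz$, $D(z)=zw$, $D(w)=xz$; $D^0$ is the identity. For a Laurent polynomial $u$, $\mathrm{Gen}(u,t)=\sum_{n\ge0}D^n(u)t^n/n!$. -}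

module Defs where

open import Data.Nat as ℕ using (ℕ; zero; suc)
open import Data.Nat.Combinatorics using (_C_)
open import Data.Integer using (+_)
open import Data.Rational as Q using (ℚ; ½; 0ℚ; 1ℚ)
open import Data.Product using (_×_; _,_; proj₁; proj₂)
open import Data.List using (List; []; _∷_; _++_; map; concatMap; foldr)
open import Data.Bool using (if_then_else_)
open import Relation.Nullary.Decidable using (⌊_⌋)
open import Relation.Binary.PropositionalEquality using (_≡_)

record Mono : Set where
  constructor mono
  field ex ey ez ew : ℕ

_≟M_ : Mono → Mono → Data.Bool.Bool
mono a b c d ≟M mono a' b' c' d' =
  ⌊ a ℕ.≟ a' ⌋ Data.Bool.∧ ⌊ b ℕ.≟ b' ⌋ Data.Bool.∧ ⌊ c ℕ.≟ c' ⌋ Data.Bool.∧ ⌊ d ℕ.≟ d' ⌋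

_·M_ : Mono → Mono → Mono
mono a b c d ·M mono a' b' c' d' = mono (a ℕ.+ a') (b ℕ.+ b') (c ℕ.+ c') (d ℕ.+ d')

Pol : Set
Pol = List (ℚ × Mono)

coeff : Pol → Mono → ℚ
coeff []            m = 0ℚ
coeff ((c , m') ∷ p) m = (if m' ≟M m then c else 0ℚ) Q.+ coeff p m

_≈P_ : Pol → Pol → Set
p ≈P q = ∀ m → coeff p m ≡ coeff q m

cst : ℚ → Pol
cst c = (c , mono 0 0 0 0) ∷ []

0P 1P : Pol
0P = []
1P = cst 1ℚ

_+P_ : Pol → Pol → Pol
p +P q = p ++ q

-P_ : Pol → Pol
-P p = map (λ { (c , m) → (Q.- c , m) }) p

_-P_ : Pol → Pol → Pol
p -P q = p +P (-P q)

_*P_ : Pol → Pol → Pol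
p *P q = concatMap (λ { (c , m) → map (λ { (c' , m') → (c Q.* c' , m ·M m') }) q }) p

varx vary varz varw : Pol
varx = (1ℚ , mono 1 0 0 0) ∷ []
vary = (1ℚ , mono 0 1 0 0) ∷ []
varz = (1ℚ , mono 0 0 1 0) ∷ []
varw = (1ℚ , mono 0 0 0 1) ∷ []

ℕ→ℚ : ℕ → ℚ
ℕ→ℚ n = (+ n) Q./ 1

-- By the Leibniz rule, on a monomial x^a y^b z^c w^d:
--   D = a x^{a-1} D(x) y^b z^c w^d + b x^a y^{b-1} D(y) z^c w^d
--     + c x^a y^b z^{c-1} D(z) w^d + d x^a y^b z^c w^{d-1} D(w)
-- with D(x)=xy, D(y)=xz, D(z)=zw, D(w)=xz.
-- (A zero multiplicity kills the corresponding term, so truncated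
-- subtraction ∸ is harmless.)

Dmono : ℚ → Mono → Pol
Dmono k (mono a b c d) =
    (k Q.* ℕ→ℚ a , mono a       (suc b)   c         d)        -- x^{a-1}·(xy)
  ∷ (k Q.* ℕ→ℚ b , mono (suc a) (b ℕ.∸ 1) (suc c)   d)        -- y^{b-1}·(xz)
  ∷ (k Q.* ℕ→ℚ c , mono a       b         c         (suc d))  -- z^{c-1}·(zw)
  ∷ (k Q.* ℕ→ℚ d , mono (suc a) b         (suc c)   (d ℕ.∸ 1)) -- w^{d-1}·(xz)
  ∷ []

D : Pol → Pol
D p = concatMap (λ { (k , m) → Dmono k m }) p

Dⁿ : ℕ → Pol → Pol
Dⁿ zero    p = p
Dⁿ (suc n) p = D (Dⁿ n p)

-- R = Pol[Δ] / (Δ² - ((w+y)² - 4xz)),  elements a + bΔ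

R : Set
R = Pol × Pol

Δ² : Pol
Δ² = ((varw +P vary) *P (varw +P vary)) -P (cst (ℕ→ℚ 4) *P (varx *P varz))

_≈R_ : R → R → Set
(a , b) ≈R (c , d) = (a ≈P c) × (b ≈P d)

ι : Pol → R
ι a = (a , 0P)

Δ : R
Δ = (0P , 1P)

0R 1R : R
0R = ι 0P
1R = ι 1P

_+R_ : R → R → R
(a , b) +R (c , d) = (a +P c , b +P d)

-R_ : R → R
-R (a , b) = (-P a , -P b)

_-R_ : R → R → R
u -R v = u +R (-R v)

_*R_ : R → R → R
(a , b) *R (c , d) = ((a *P c) +P ((b *P d) *P Δ²) , (a *P d) +P (b *P c))

ℕ→R : ℕ → R
ℕ→R n = ι (cst (ℕ→ℚ n))

_^R_ : R → ℕ → R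
u ^R zero  = 1R
u ^R suc n = u *R (u ^R n)

-- Formal power series in t over R, via exponential coefficients:
-- f : ℕ → R represents Σ_n f n · tⁿ/n!.

Series : Set
Series = ℕ → R

ΣR : ℕ → (ℕ → R) → R
ΣR zero    g = g zero
ΣR (suc n) g = ΣR n g +R g (suc n)

-- product of power series (in exponential coefficients: binomial convolution)
_⋆_ : Series → Series → Series
(f ⋆ g) n = ΣR n (λ k → ℕ→R (n C k) *R (f k *R g (n ℕ.∸ k)))

_⊕_ _⊖_ : Series → Series → Series
(f ⊕ g) n = f n +R g n
(f ⊖ g) n = f n -R g n

const : R → Series
const u zero    = u
const u (suc n) = 0R

expS : R → Series
expS α n = α ^R n

_≈S_ : Series → Series → Set
f ≈S g = ∀ n → f n ≈R g n

Gen : Pol → Series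
Gen u n = ι (Dⁿ n u)

wR yR zR : R
wR = ι varw
yR = ι vary
zR = ι varz

½R : R
½R = ι (cst ½)

numS : Series
numS = const (ℕ→R 2 *R (zR *R Δ)) ⋆ expS (½R *R ((wR -R yR) +R Δ))

denS : Series
denS = const ((wR +R yR) +R Δ) ⊖ (const ((wR +R yR) -R Δ) ⋆ expS Δ)

module Submission where

-- Write a = w + y + Δ, b = w + y − Δ, K = 2zΔ, α = (w − y + Δ)/2 and E = Gen(z,t)·e^{tΔ}.
-- Multiplied out, the claim says that the t-coefficients satisfy a·Dⁿz − b·Eₙ = K·αⁿ.
-- Since DΔ = 0 we have E_{n+1} = D Eₙ + Δ Eₙ, and D(w + y) = 2xz, DK = 2zwΔ, Dα = 0.
-- Hence the defect Fₙ = a·Dⁿz − b·Eₙ − K·αⁿ satisfies the ring identity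
--   F_{n+1} = D Fₙ − (b/2) Fₙ + ½ (Dⁿz − Eₙ) ((w + y)² − 4xz − Δ²),
-- whose last term vanishes; as F₀ = 0, all Fₙ vanish.  D is defined on list representations
-- of polynomials; it respects equality of coefficients because it agrees with the chain
-- rule D = Σᵥ D(v)·∂/∂v, and it extends to Pol[Δ] since D((w + y)² − 4xz) = 0.

open import Defs using (ℕ→ℚ)
open import Level using (0ℓ)
open import Algebra.Bundles using (CommutativeRing; CommutativeMonoid)
import Algebra.Properties.CommutativeSemigroup
import Algebra.Solver.Ring.NaturalCoefficients.Default
open import Algebra.Solver.Ring.AlmostCommutativeRing
  using (_-Raw-AlmostCommutative⟶_; -raw-almostCommutative⟶; fromCommutativeRing; Induced-equivalence)
open import Data.Bool using (true; false; if_then_else_)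
open import Data.Integer as ℤ using (+_)
import Data.Integer.Properties as ℤ
open import Data.List using ([]; _∷_; _++_; map; [_])
import Data.List.Properties as List
open import Data.Maybe using (just; nothing)
open import Data.Nat as ℕ using (ℕ; zero; suc; _≤_; z≤n)
import Data.Nat.Properties as ℕ
open import Data.Nat.Combinatorics using (_C_; nCk+nC[k+1]≡[n+1]C[k+1]; k>n⇒nCk≡0; nCn≡1)
import Data.Nat.Coprimality as Coprime
open import Data.Product using (_×_; _,_; proj₁; proj₂; ∃-syntax)
open import Data.Rational as ℚ using (ℚ; 0ℚ; 1ℚ; ½)
import Data.Rational.Properties as ℚ
open import Function using (_∘_)
open import Relation.Binary.Definitions using (DecidableEquality; WeaklyDecidable)
open import Relation.Binary.PropositionalEquality as ≡ using (_≡_)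
open import Relation.Nullary using (Dec; yes; no; ¬_; does; contradiction)
open import Relation.Nullary.Decidable using (map′; _×-dec_; dec-true; dec-false; isYes≗does)

-- ℚ._+_ computes on the normal forms mkℚ (+ k) 0, and ℕ→ℚ k is one by normalize-coprime.
ℕ→ℚ-+ : ∀ m n → ℕ→ℚ (m ℕ.+ n) ≡ ℕ→ℚ m ℚ.+ ℕ→ℚ n
ℕ→ℚ-+ m n = begin
  + (m ℕ.+ n) ℚ./ 1                           ≡⟨ ℚ./-cong {q₁ = 1} (≡.sym numerator) ≡.refl ⟩
  (+ m ℤ.* + 1 ℤ.+ + n ℤ.* + 1) ℚ./ 1         ≡⟨⟩
  ℚ.mkℚ (+ m) 0 (coprime m) ℚ.+ ℚ.mkℚ (+ n) 0 (coprime n)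
    ≡⟨ ≡.cong₂ ℚ._+_ (ℚ.normalize-coprime (coprime m)) (ℚ.normalize-coprime (coprime n)) ⟨
  ℕ→ℚ m ℚ.+ ℕ→ℚ n                             ∎
  where
  open ≡.≡-Reasoning
  coprime : ∀ k → Coprime.Coprime k 1
  coprime k = Coprime.sym (Coprime.1-coprimeTo k)
  numerator : + m ℤ.* + 1 ℤ.+ + n ℤ.* + 1 ≡ + (m ℕ.+ n)
  numerator = ≡.trans (≡.cong₂ ℤ._+_ (ℤ.*-identityʳ (+ m)) (ℤ.*-identityʳ (+ n))) (≡.sym (ℤ.pos-+ m n))

module ℚ-Solver (A : CommutativeRing 0ℓ 0ℓ)
                (from-ℚ : ℚ.+-*-rawRing -Raw-AlmostCommutative⟶ fromCommutativeRing A) where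

  open CommutativeRing A using (refl)

  coefficient-equality : WeaklyDecidable (Induced-equivalence from-ℚ)
  coefficient-equality p q with p ℚ.≟ q
  ... | yes ≡.refl = just refl
  ... | no _       = nothing

  open import Algebra.Solver.Ring ℚ.+-*-rawRing (fromCommutativeRing A) from-ℚ coefficient-equality public
    using (solve; _:=_; _:+_; _:*_; _:-_; :-_; con)

record IsDerivation (A : CommutativeRing 0ℓ 0ℓ) (δ : CommutativeRing.Carrier A → CommutativeRing.Carrier A) : Set where
  open CommutativeRing A
  field
    δ-cong  : ∀ {u v} → u ≈ v → δ u ≈ δ v
    δ-+     : ∀ u v → δ (u + v) ≈ δ u + δ v
    leibniz : ∀ u v → δ (u * v) ≈ δ u * v + u * δ v

module DerivationProperties {A : CommutativeRing 0ℓ 0ℓ} {δ} (isDerivation : IsDerivation A δ) where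

  open CommutativeRing A
  open IsDerivation isDerivation public
  open import Algebra.Properties.Group +-group using (identityˡ-unique; inverseˡ-unique)
  open import Relation.Binary.Reasoning.Setoid setoid

  δ-0 : δ 0# ≈ 0#
  δ-0 = identityˡ-unique (δ 0#) (δ 0#) (begin
    δ 0# + δ 0#  ≈⟨ δ-+ 0# 0# ⟨
    δ (0# + 0#)  ≈⟨ δ-cong (+-identityˡ 0#) ⟩
    δ 0#         ∎)

  δ-1 : δ 1# ≈ 0#
  δ-1 = identityˡ-unique (δ 1#) (δ 1#) (begin
    δ 1# + δ 1#            ≈⟨ +-cong (*-identityʳ (δ 1#)) (*-identityˡ (δ 1#)) ⟨
    δ 1# * 1# + 1# * δ 1#  ≈⟨ leibniz 1# 1# ⟨
    δ (1# * 1#)            ≈⟨ δ-cong (*-identityˡ 1#) ⟩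
    δ 1#                   ∎)

  δ-neg : ∀ u → δ (- u) ≈ - δ u
  δ-neg u = inverseˡ-unique (δ (- u)) (δ u) (begin
    δ (- u) + δ u  ≈⟨ δ-+ (- u) u ⟨
    δ (- u + u)    ≈⟨ δ-cong (-‿inverseˡ u) ⟩
    δ 0#           ≈⟨ δ-0 ⟩
    0#             ∎)

  δ-- : ∀ u v → δ (u - v) ≈ δ u - δ v
  δ-- u v = trans (δ-+ u (- v)) (+-congˡ (δ-neg v))

  δ-const-* : ∀ {k} u → δ k ≈ 0# → δ (k * u) ≈ k * δ u
  δ-const-* {k} u δk≈0 = begin
    δ (k * u)          ≈⟨ leibniz k u ⟩
    δ k * u + k * δ u  ≈⟨ +-congʳ (trans (*-congʳ δk≈0) (zeroˡ u)) ⟩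
    0# + k * δ u       ≈⟨ +-identityˡ _ ⟩
    k * δ u            ∎

  recurrence-vanishes : ∀ (F : ℕ → Carrier) c → F 0 ≈ 0# → (∀ n → F (suc n) ≈ δ (F n) + c * F n) →
                        ∀ n → F n ≈ 0#
  recurrence-vanishes F c F₀ F-suc zero    = F₀
  recurrence-vanishes F c F₀ F-suc (suc n) = begin
    F (suc n)          ≈⟨ F-suc n ⟩
    δ (F n) + c * F n  ≈⟨ +-cong (trans (δ-cong Fn≈0) δ-0) (trans (*-congˡ Fn≈0) (zeroʳ c)) ⟩
    0# + 0#            ≈⟨ +-identityʳ 0# ⟩
    0#                 ∎
    where
    Fn≈0 : F n ≈ 0#
    Fn≈0 = recurrence-vanishes F c F₀ F-suc n

-- Exponential generating functions

module ExponentialSeries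
  (A : CommutativeRing 0ℓ 0ℓ)
  (from-ℚ : ℚ.+-*-rawRing -Raw-AlmostCommutative⟶ fromCommutativeRing A)
  where

  open CommutativeRing A hiding (zero)
  open _-Raw-AlmostCommutative⟶_ from-ℚ
  open ℚ-Solver A from-ℚ using (solve; _:=_; _:+_; _:*_; _:-_; :-_)
  open import Relation.Binary.Reasoning.Setoid setoid

  sum : ℕ → (ℕ → Carrier) → Carrier
  sum zero    g = g zero
  sum (suc n) g = sum n g + g (suc n)

  binomial : ℕ → ℕ → Carrier
  binomial n k = ⟦ ℕ→ℚ (n C k) ⟧

  infixl 7 _⋆_
  infixl 6 _⊖_

  _⋆_ : (ℕ → Carrier) → (ℕ → Carrier) → ℕ → Carrier
  (f ⋆ g) n = sum n (λ k → binomial n k * (f k * g (n ℕ.∸ k)))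

  _⊖_ : (ℕ → Carrier) → (ℕ → Carrier) → ℕ → Carrier
  (f ⊖ g) n = f n - g n

  constant : Carrier → ℕ → Carrier
  constant u zero    = u
  constant u (suc n) = 0#

  exp : Carrier → ℕ → Carrier
  exp u zero    = 1#
  exp u (suc n) = u * exp u n

  sum-cong : ∀ n {g h : ℕ → Carrier} → (∀ k → k ≤ n → g k ≈ h k) → sum n g ≈ sum n h
  sum-cong zero    g≈h = g≈h 0 z≤n
  sum-cong (suc n) g≈h = +-cong (sum-cong n (λ k k≤n → g≈h k (ℕ.m≤n⇒m≤1+n k≤n))) (g≈h (suc n) ℕ.≤-refl)

  sum-shift : ∀ n (g : ℕ → Carrier) → sum (suc n) g ≈ g 0 + sum n (g ∘ suc)
  sum-shift zero    g = refl
  sum-shift (suc n) g = trans (+-congʳ (sum-shift n g)) (+-assoc (g 0) (sum n (g ∘ suc)) (g (suc (suc n))))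

  sum-+ : ∀ n (g h : ℕ → Carrier) → sum n (λ k → g k + h k) ≈ sum n g + sum n h
  sum-+ zero    g h = refl
  sum-+ (suc n) g h = trans (+-congʳ (sum-+ n g h))
    (solve 4 (λ a b c d → (a :+ b) :+ (c :+ d) := (a :+ c) :+ (b :+ d)) refl (sum n g) (sum n h) (g (suc n)) (h (suc n)))

  sum-*ˡ : ∀ n c (g : ℕ → Carrier) → c * sum n g ≈ sum n (λ k → c * g k)
  sum-*ˡ zero    c g = refl
  sum-*ˡ (suc n) c g = trans (distribˡ c (sum n g) (g (suc n))) (+-congʳ (sum-*ˡ n c g))

  sum-neg : ∀ n (g : ℕ → Carrier) → sum n (λ k → - g k) ≈ - sum n g
  sum-neg zero    g = refl
  sum-neg (suc n) g = trans (+-congʳ (sum-neg n g)) (-‿+-comm (sum n g) (g (suc n)))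
    where open import Algebra.Properties.Ring ring using (-‿+-comm)

  sum-zero : ∀ n (g : ℕ → Carrier) → (∀ k → k ≤ n → g k ≈ 0#) → sum n g ≈ 0#
  sum-zero n g g≈0 = trans (sum-cong n g≈0) (zeros n)
    where
    zeros : ∀ n → sum n (λ _ → 0#) ≈ 0#
    zeros zero    = refl
    zeros (suc n) = trans (+-congʳ (zeros n)) (+-identityʳ 0#)

  binomial-≡ : ∀ n k {j} → n C k ≡ j → binomial n k ≈ ⟦ ℕ→ℚ j ⟧
  binomial-≡ n k nCk≡j = reflexive (≡.cong (⟦_⟧ ∘ ℕ→ℚ) nCk≡j)

  binomial-0 : ∀ n → binomial n 0 ≈ 1#
  binomial-0 n = 1-homo

  binomial-n : ∀ n → binomial n n ≈ 1#
  binomial-n n = trans (binomial-≡ n n (nCn≡1 n)) 1-homo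

  binomial-overflow : ∀ n → binomial n (suc n) ≈ 0#
  binomial-overflow n = trans (binomial-≡ n (suc n) (k>n⇒nCk≡0 (ℕ.n<1+n n))) 0-homo

  binomial-pascal : ∀ n k → binomial (suc n) (suc k) ≈ binomial n k + binomial n (suc k)
  binomial-pascal n k = begin
    binomial (suc n) (suc k)                   ≈⟨ binomial-≡ (suc n) (suc k) (≡.sym (nCk+nC[k+1]≡[n+1]C[k+1] n k)) ⟩
    ⟦ ℕ→ℚ (n C k ℕ.+ n C suc k) ⟧              ≈⟨ reflexive (≡.cong ⟦_⟧ (ℕ→ℚ-+ (n C k) (n C suc k))) ⟩
    ⟦ ℕ→ℚ (n C k) ℚ.+ ℕ→ℚ (n C suc k) ⟧        ≈⟨ +-homo (ℕ→ℚ (n C k)) (ℕ→ℚ (n C suc k)) ⟩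
    binomial n k + binomial n (suc k)          ∎

  ⋆-congˡ : ∀ {f g} h n → (∀ j → f j ≈ g j) → (f ⋆ h) n ≈ (g ⋆ h) n
  ⋆-congˡ h n f≈g = sum-cong n (λ k _ → *-congˡ (*-congʳ (f≈g k)))

  ⋆-congʳ : ∀ f {g h} n → (∀ j → g j ≈ h j) → (f ⋆ g) n ≈ (f ⋆ h) n
  ⋆-congʳ f n g≈h = sum-cong n (λ k _ → *-congˡ (*-congˡ (g≈h (n ℕ.∸ k))))

  ⋆-*ʳ : ∀ f g c n → (f ⋆ (λ j → c * g j)) n ≈ c * (f ⋆ g) n
  ⋆-*ʳ f g c n = trans
    (sum-cong n (λ k _ → solve 4 (λ b u c v → b :* (u :* (c :* v)) := c :* (b :* (u :* v))) refl (binomial n k) (f k) c (g (n ℕ.∸ k))))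
    (sym (sum-*ˡ n c (λ k → binomial n k * (f k * g (n ℕ.∸ k)))))

  ⋆-distribˡ-⊖ : ∀ f g h n → (f ⋆ (g ⊖ h)) n ≈ (f ⋆ g) n - (f ⋆ h) n
  ⋆-distribˡ-⊖ f g h n = begin
    (f ⋆ (g ⊖ h)) n
      ≈⟨ sum-cong n (λ k _ → solve 4 (λ b u v v′ → b :* (u :* (v :- v′)) := b :* (u :* v) :+ (:- (b :* (u :* v′))))
                                     refl (binomial n k) (f k) (g (n ℕ.∸ k)) (h (n ℕ.∸ k))) ⟩
    sum n (λ k → binomial n k * (f k * g (n ℕ.∸ k)) + - (binomial n k * (f k * h (n ℕ.∸ k))))
      ≈⟨ sum-+ n (λ k → binomial n k * (f k * g (n ℕ.∸ k))) (λ k → - (binomial n k * (f k * h (n ℕ.∸ k)))) ⟩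
    (f ⋆ g) n + sum n (λ k → - (binomial n k * (f k * h (n ℕ.∸ k))))
      ≈⟨ +-congˡ (sum-neg n (λ k → binomial n k * (f k * h (n ℕ.∸ k)))) ⟩
    (f ⋆ g) n - (f ⋆ h) n ∎

  constant-⋆ : ∀ c f n → (constant c ⋆ f) n ≈ c * f n
  constant-⋆ c f zero    = trans (*-congʳ (binomial-0 0)) (*-identityˡ (c * f 0))
  constant-⋆ c f (suc n) = begin
    (constant c ⋆ f) (suc n)
      ≈⟨ sum-shift n _ ⟩
    binomial (suc n) 0 * (c * f (suc n)) + sum n (λ k → binomial (suc n) (suc k) * (0# * f (n ℕ.∸ k)))
      ≈⟨ +-cong (trans (*-congʳ (binomial-0 (suc n))) (*-identityˡ _)) (sum-zero n _ (λ k _ → trans (*-congˡ (zeroˡ _)) (zeroʳ _))) ⟩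
    c * f (suc n) + 0#
      ≈⟨ +-identityʳ _ ⟩
    c * f (suc n) ∎

  ⋆-constant : ∀ f c n → (f ⋆ constant c) n ≈ f n * c
  ⋆-constant f c zero    = trans (*-congʳ (binomial-0 0)) (*-identityˡ (f 0 * c))
  ⋆-constant f c (suc n) = begin
    sum n t + t (suc n)
      ≈⟨ +-cong (sum-zero n t vanishes) (trans (*-cong (binomial-n (suc n)) (*-congˡ (reflexive (≡.cong (constant c) (ℕ.n∸n≡0 n))))) (*-identityˡ _)) ⟩
    0# + f (suc n) * c
      ≈⟨ +-identityˡ _ ⟩
    f (suc n) * c ∎
    where
    t : ℕ → Carrier
    t k = binomial (suc n) k * (f k * constant c (suc n ℕ.∸ k))
    vanishes : ∀ k → k ≤ n → t k ≈ 0#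
    vanishes k k≤n = trans (*-congˡ (*-congˡ (reflexive (≡.cong (constant c) (ℕ.+-∸-assoc 1 k≤n)))))
                           (trans (*-congˡ (zeroʳ (f k))) (zeroʳ _))

  -- The Leibniz rule for d/dt, which acts on coefficient sequences as the shift.
  ⋆-suc : ∀ f g n → (f ⋆ g) (suc n) ≈ ((f ∘ suc) ⋆ g) n + (f ⋆ (g ∘ suc)) n
  ⋆-suc f g n = begin
    (f ⋆ g) (suc n)
      ≈⟨ sum-shift n _ ⟩
    h 0 + sum n (λ k → binomial (suc n) (suc k) * F k)
      ≈⟨ +-congˡ (sum-cong n (λ k _ → trans (*-congʳ (binomial-pascal n k)) (distribʳ (F k) (binomial n k) (binomial n (suc k))))) ⟩
    h 0 + sum n (λ k → binomial n k * F k + binomial n (suc k) * F k)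
      ≈⟨ +-congˡ (sum-+ n (λ k → binomial n k * F k) (h ∘ suc)) ⟩
    h 0 + (((f ∘ suc) ⋆ g) n + sum n (h ∘ suc))
      ≈⟨ x∙yz≈y∙xz (h 0) (((f ∘ suc) ⋆ g) n) (sum n (h ∘ suc)) ⟩
    ((f ∘ suc) ⋆ g) n + (h 0 + sum n (h ∘ suc))
      ≈⟨ +-congˡ (sym (sum-shift n h)) ⟩
    ((f ∘ suc) ⋆ g) n + (sum n h + h (suc n))
      ≈⟨ +-congˡ (trans (+-congˡ (trans (*-congʳ (binomial-overflow n)) (zeroˡ _))) (+-identityʳ _)) ⟩
    ((f ∘ suc) ⋆ g) n + sum n h
      ≈⟨ +-congˡ (sum-cong n (λ k k≤n → *-congˡ (*-congˡ (reflexive (≡.cong g (ℕ.+-∸-assoc 1 k≤n)))))) ⟩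
    ((f ∘ suc) ⋆ g) n + (f ⋆ (g ∘ suc)) n ∎
    where
    open import Algebra.Properties.CommutativeSemigroup +-commutativeSemigroup using (x∙yz≈y∙xz)
    F : ℕ → Carrier
    F k = f (suc k) * g (n ℕ.∸ k)
    h : ℕ → Carrier
    h k = binomial n k * (f k * g (suc n ℕ.∸ k))

  module _ {δ : Carrier → Carrier} (isDerivation : IsDerivation A δ) (δ-ℚ : ∀ c → δ ⟦ c ⟧ ≈ 0#) where

    open DerivationProperties isDerivation

    δ-sum : ∀ n (g : ℕ → Carrier) → δ (sum n g) ≈ sum n (δ ∘ g)
    δ-sum zero    g = refl
    δ-sum (suc n) g = trans (δ-+ (sum n g) (g (suc n))) (+-congʳ (δ-sum n g))

    δ-⋆ : ∀ f g n → (∀ j → δ (g j) ≈ 0#) → δ ((f ⋆ g) n) ≈ ((δ ∘ f) ⋆ g) n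
    δ-⋆ f g n δg≈0 = trans (δ-sum n _) (sum-cong n (λ k _ → term k))
      where
      term : ∀ k → δ (binomial n k * (f k * g (n ℕ.∸ k))) ≈ binomial n k * (δ (f k) * g (n ℕ.∸ k))
      term k = begin
        δ (binomial n k * (f k * g (n ℕ.∸ k)))
          ≈⟨ δ-const-* (f k * g (n ℕ.∸ k)) (δ-ℚ (ℕ→ℚ (n C k))) ⟩
        binomial n k * δ (f k * g (n ℕ.∸ k))
          ≈⟨ *-congˡ (trans (leibniz (f k) (g (n ℕ.∸ k))) (+-congˡ (trans (*-congˡ (δg≈0 (n ℕ.∸ k))) (zeroʳ (f k))))) ⟩
        binomial n k * (δ (f k) * g (n ℕ.∸ k) + 0#)
          ≈⟨ *-congˡ (+-identityʳ _) ⟩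
        binomial n k * (δ (f k) * g (n ℕ.∸ k)) ∎

    δ-exp : ∀ {u} → δ u ≈ 0# → ∀ n → δ (exp u n) ≈ 0#
    δ-exp     δu≈0 zero    = δ-1
    δ-exp {u} δu≈0 (suc n) = trans (δ-const-* (exp u n) δu≈0) (trans (*-congˡ (δ-exp δu≈0 n)) (zeroʳ u))

-- Adjoining a square root

module Adjoin√ (A : CommutativeRing 0ℓ 0ℓ) (d : CommutativeRing.Carrier A) where

  private module A = CommutativeRing A
  open A using (_+_; _*_; -_; 0#; 1#; _≈_)
  open import Algebra.Solver.Ring.NaturalCoefficients.Default A.commutativeSemiring using (solve; _:=_; _:+_; _:*_; con)
  open import Algebra.Properties.Ring A.ring using (-0#≈0#)

  infix 4 _≋_
  record _≋_ (u v : A.Carrier × A.Carrier) : Set where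
    constructor _&_
    field
      ≈₁ : proj₁ u ≈ proj₁ v
      ≈₂ : proj₂ u ≈ proj₂ v

  commutativeRing : CommutativeRing 0ℓ 0ℓ
  commutativeRing = record
    { Carrier = A.Carrier × A.Carrier
    ; _≈_ = _≋_
    ; _+_ = λ (a , b) (c , e) → (a + c , b + e)
    ; _*_ = λ (a , b) (c , e) → ((a * c) + ((b * e) * d) , (a * e) + (b * c))
    ; -_ = λ (a , b) → (- a , - b)
    ; 0# = (0# , 0#)
    ; 1# = (1# , 0#)
    ; isCommutativeRing = record
      { isRing = record
        { +-isAbelianGroup = record
          { isGroup = record
            { isMonoid = record
              { isSemigroup = record
                { isMagma = record
                  { isEquivalence = record
                    { refl = A.refl & A.refl
                    ; sym = λ (p & q) → A.sym p & A.sym q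
                    ; trans = λ (p & q) (p′ & q′) → A.trans p p′ & A.trans q q′ }
                  ; ∙-cong = λ (p & q) (p′ & q′) → A.+-cong p p′ & A.+-cong q q′ }
                ; assoc = λ _ _ _ → A.+-assoc _ _ _ & A.+-assoc _ _ _ }
              ; identity = (λ _ → A.+-identityˡ _ & A.+-identityˡ _) , (λ _ → A.+-identityʳ _ & A.+-identityʳ _) }
            ; inverse = (λ _ → A.-‿inverseˡ _ & A.-‿inverseˡ _) , (λ _ → A.-‿inverseʳ _ & A.-‿inverseʳ _)
            ; ⁻¹-cong = λ (p & q) → A.-‿cong p & A.-‿cong q }
          ; comm = λ _ _ → A.+-comm _ _ & A.+-comm _ _ }
        ; *-cong = λ (p & q) (p′ & q′) →
            A.+-cong (A.*-cong p p′) (A.*-congʳ (A.*-cong q q′)) & A.+-cong (A.*-cong p q′) (A.*-cong q p′)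
        ; *-assoc = λ (a , b) (c , e) (f , g) →
              solve 7 (λ a b c e f g d → (a :* c :+ b :* e :* d) :* f :+ ((a :* e :+ b :* c) :* g) :* d
                                      := a :* (c :* f :+ e :* g :* d) :+ (b :* (c :* g :+ e :* f)) :* d) A.refl a b c e f g d
            & solve 7 (λ a b c e f g d → (a :* c :+ b :* e :* d) :* g :+ (a :* e :+ b :* c) :* f
                                      := a :* (c :* g :+ e :* f) :+ b :* (c :* f :+ e :* g :* d)) A.refl a b c e f g d
        ; *-identity = (λ (a , b) → solve 3 (λ a b d → con 1 :* a :+ con 0 :* b :* d := a) A.refl a b d
                                   & solve 2 (λ a b → con 1 :* b :+ con 0 :* a := b) A.refl a b)
                     , (λ (a , b) → solve 3 (λ a b d → a :* con 1 :+ b :* con 0 :* d := a) A.refl a b d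
                                   & solve 2 (λ a b → a :* con 0 :+ b :* con 1 := b) A.refl a b)
        ; distrib = (λ (a , b) (c , e) (f , g) →
                        solve 7 (λ a b c e f g d → a :* (c :+ f) :+ b :* (e :+ g) :* d
                                                := (a :* c :+ b :* e :* d) :+ (a :* f :+ b :* g :* d)) A.refl a b c e f g d
                      & solve 6 (λ a b c e f g → a :* (e :+ g) :+ b :* (c :+ f)
                                              := (a :* e :+ b :* c) :+ (a :* g :+ b :* f)) A.refl a b c e f g)
                  , (λ (a , b) (c , e) (f , g) →
                        solve 7 (λ a b c e f g d → (c :+ f) :* a :+ (e :+ g) :* b :* d
                                                := (c :* a :+ e :* b :* d) :+ (f :* a :+ g :* b :* d)) A.refl a b c e f g d
                      & solve 6 (λ a b c e f g → (c :+ f) :* b :+ (e :+ g) :* a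
                                              := (c :* b :+ e :* a) :+ (f :* b :+ g :* a)) A.refl a b c e f g) }
      ; *-comm = λ (a , b) (c , e) →
            solve 5 (λ a b c e d → a :* c :+ b :* e :* d := c :* a :+ e :* b :* d) A.refl a b c e d
          & solve 4 (λ a b c e → a :* e :+ b :* c := c :* b :+ e :* a) A.refl a b c e } }

  private module E = CommutativeRing commutativeRing

  ι : A.Carrier → A.Carrier × A.Carrier
  ι a = (a , 0#)

  √d : A.Carrier × A.Carrier
  √d = (0# , 1#)

  ι-cong : ∀ {a b} → a ≈ b → ι a ≋ ι b
  ι-cong p = p & A.refl

  ι-morphism : A.rawRing -Raw-AlmostCommutative⟶ fromCommutativeRing commutativeRing
  ι-morphism = record
    { ⟦_⟧    = ι
    ; +-homo = λ a b → A.refl & A.sym (A.+-identityˡ 0#)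
    ; *-homo = λ a b → solve 3 (λ a b d → a :* b := a :* b :+ con 0 :* con 0 :* d) A.refl a b d
                     & solve 2 (λ a b → con 0 := a :* con 0 :+ con 0 :* b) A.refl a b
    ; -‿homo = λ a → A.refl & A.sym -0#≈0#
    ; 0-homo = A.refl & A.refl
    ; 1-homo = A.refl & A.refl
    }

  √d*√d : √d E.* √d ≋ ι d
  √d*√d = solve 1 (λ d → con 0 :* con 0 :+ con 1 :* con 1 :* d := d) A.refl d
        & solve 0 (con 0 :* con 1 :+ con 1 :* con 0 := con 0) A.refl

  lift-ℚ : ℚ.+-*-rawRing -Raw-AlmostCommutative⟶ fromCommutativeRing A →
           ℚ.+-*-rawRing -Raw-AlmostCommutative⟶ fromCommutativeRing commutativeRing
  lift-ℚ φ = record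
    { ⟦_⟧    = λ c → ι ⟦ c ⟧
    ; +-homo = λ p q → E.trans (ι-cong (+-homo p q)) (ι-hom.+-homo ⟦ p ⟧ ⟦ q ⟧)
    ; *-homo = λ p q → E.trans (ι-cong (*-homo p q)) (ι-hom.*-homo ⟦ p ⟧ ⟦ q ⟧)
    ; -‿homo = λ p → E.trans (ι-cong (-‿homo p)) (ι-hom.-‿homo ⟦ p ⟧)
    ; 0-homo = E.trans (ι-cong 0-homo) ι-hom.0-homo
    ; 1-homo = E.trans (ι-cong 1-homo) ι-hom.1-homo
    }
    where
    open _-Raw-AlmostCommutative⟶_ φ
    module ι-hom = _-Raw-AlmostCommutative⟶_ ι-morphism

  lift-derivation : ∀ {δ} → IsDerivation A δ → δ d ≈ 0# → IsDerivation commutativeRing (λ (a , b) → (δ a , δ b))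
  lift-derivation {δ} isDerivation δd≈0 = record
    { δ-cong  = λ (p & q) → δ-cong p & δ-cong q
    ; δ-+     = λ _ _ → δ-+ _ _ & δ-+ _ _
    ; leibniz = λ (a , b) (c , e) → leibniz₁ a b c e & leibniz₂ a b c e
    }
    where
    open DerivationProperties isDerivation
    open import Relation.Binary.Reasoning.Setoid A.setoid

    leibniz₁ : ∀ a b c e → δ (a * c + (b * e) * d) ≈ (δ a * c + (δ b * e) * d) + (a * δ c + (b * δ e) * d)
    leibniz₁ a b c e = begin
      δ (a * c + (b * e) * d)
        ≈⟨ A.trans (δ-+ _ _) (A.+-cong (leibniz a c) (A.trans (leibniz (b * e) d) (A.+-cong (A.*-congʳ (leibniz b e)) (A.*-congˡ δd≈0)))) ⟩
      (δ a * c + a * δ c) + ((δ b * e + b * δ e) * d + (b * e) * 0#)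
        ≈⟨ solve 9 (λ a b c e d a′ b′ c′ e′ → (a′ :* c :+ a :* c′) :+ ((b′ :* e :+ b :* e′) :* d :+ b :* e :* con 0)
                                            := (a′ :* c :+ b′ :* e :* d) :+ (a :* c′ :+ b :* e′ :* d))
                   A.refl a b c e d (δ a) (δ b) (δ c) (δ e) ⟩
      (δ a * c + (δ b * e) * d) + (a * δ c + (b * δ e) * d) ∎

    leibniz₂ : ∀ a b c e → δ (a * e + b * c) ≈ (δ a * e + δ b * c) + (a * δ e + b * δ c)
    leibniz₂ a b c e = begin
      δ (a * e + b * c)
        ≈⟨ A.trans (δ-+ _ _) (A.+-cong (leibniz a e) (leibniz b c)) ⟩
      (δ a * e + a * δ e) + (δ b * c + b * δ c)
        ≈⟨ solve 4 (λ p q r s → (p :+ q) :+ (r :+ s) := (p :+ r) :+ (q :+ s)) A.refl (δ a * e) (a * δ e) (δ b * c) (b * δ c) ⟩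
      (δ a * e + δ b * c) + (a * δ e + b * δ c) ∎

-- The identity for an abstract grammar

module _ (A : CommutativeRing 0ℓ 0ℓ) (from-ℚ : ℚ.+-*-rawRing -Raw-AlmostCommutative⟶ fromCommutativeRing A) where

  open CommutativeRing A
  open _-Raw-AlmostCommutative⟶_ from-ℚ

  module Grammar
    {δ : Carrier → Carrier} (isDerivation : IsDerivation A δ) (δ-ℚ : ∀ c → δ ⟦ c ⟧ ≈ 0#)
    (x y z w : Carrier) (δx : δ x ≈ x * y) (δy : δ y ≈ x * z) (δz : δ z ≈ z * w) (δw : δ w ≈ x * z)
    where

    open DerivationProperties isDerivation
    open ℚ-Solver A from-ℚ using (solve; _:=_; _:+_; _:*_; _:-_; :-_; con)
    open ExponentialSeries A from-ℚ
    open import Relation.Binary.Reasoning.Setoid setoid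
    open import Algebra.Properties.Ring ring using (-0#≈0#)
    open import Algebra.Properties.Group +-group using (x≈y⇒x∙y⁻¹≈ε; x∙y⁻¹≈ε⇒x≈y)

    discriminant : Carrier
    discriminant = (w + y) * (w + y) - ⟦ ℕ→ℚ 4 ⟧ * (x * z)

    δ[w+y] : δ (w + y) ≈ x * z + x * z
    δ[w+y] = trans (δ-+ w y) (+-cong δw δy)

    δ-discriminant : δ discriminant ≈ 0#
    δ-discriminant = begin
      δ ((w + y) * (w + y) - ⟦ ℕ→ℚ 4 ⟧ * (x * z))
        ≈⟨ δ-- ((w + y) * (w + y)) (⟦ ℕ→ℚ 4 ⟧ * (x * z)) ⟩
      δ ((w + y) * (w + y)) - δ (⟦ ℕ→ℚ 4 ⟧ * (x * z))
        ≈⟨ +-cong (trans (leibniz (w + y) (w + y)) (+-cong (*-congʳ δ[w+y]) (*-congˡ δ[w+y])))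
                  (-‿cong (trans (δ-const-* (x * z) (δ-ℚ (ℕ→ℚ 4))) (*-congˡ (trans (leibniz x z) (+-cong (*-congʳ δx) (*-congˡ δz)))))) ⟩
      ((x * z + x * z) * (w + y) + (w + y) * (x * z + x * z)) - ⟦ ℕ→ℚ 4 ⟧ * ((x * y) * z + x * (z * w))
        ≈⟨ solve 4 (λ x y z w → ((x :* z :+ x :* z) :* (w :+ y) :+ (w :+ y) :* (x :* z :+ x :* z))
                                  :- con (ℕ→ℚ 4) :* ((x :* y) :* z :+ x :* (z :* w)) := con ℚ.0ℚ) refl x y z w ⟩
      ⟦ ℚ.0ℚ ⟧
        ≈⟨ 0-homo ⟩
      0# ∎

    module _ (Δ : Carrier) (δΔ : δ Δ ≈ 0#) (Δ*Δ : Δ * Δ ≈ discriminant) where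

      a b K α : Carrier
      a = (w + y) + Δ
      b = (w + y) - Δ
      K = ⟦ ℕ→ℚ 2 ⟧ * (z * Δ)
      α = ⟦ ½ ⟧ * ((w - y) + Δ)

      δa : δ a ≈ x * z + x * z
      δa = trans (δ-+ (w + y) Δ) (trans (+-cong δ[w+y] δΔ) (+-identityʳ _))

      δb : δ b ≈ x * z + x * z
      δb = trans (δ-- (w + y) Δ) (trans (+-cong δ[w+y] (trans (-‿cong δΔ) -0#≈0#)) (+-identityʳ _))

      δK : δ K ≈ ⟦ ℕ→ℚ 2 ⟧ * ((z * w) * Δ)
      δK = begin
        δ K                                            ≈⟨ δ-const-* (z * Δ) (δ-ℚ (ℕ→ℚ 2)) ⟩
        ⟦ ℕ→ℚ 2 ⟧ * δ (z * Δ)                          ≈⟨ *-congˡ (leibniz z Δ) ⟩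
        ⟦ ℕ→ℚ 2 ⟧ * (δ z * Δ + z * δ Δ)                ≈⟨ *-congˡ (+-cong (*-congʳ δz) (trans (*-congˡ δΔ) (zeroʳ z))) ⟩
        ⟦ ℕ→ℚ 2 ⟧ * ((z * w) * Δ + 0#)                 ≈⟨ *-congˡ (+-identityʳ _) ⟩
        ⟦ ℕ→ℚ 2 ⟧ * ((z * w) * Δ)                      ∎

      δα : δ α ≈ 0#
      δα = begin
        δ α                                   ≈⟨ δ-const-* ((w - y) + Δ) (δ-ℚ ½) ⟩
        ⟦ ½ ⟧ * δ ((w - y) + Δ)               ≈⟨ *-congˡ (trans (δ-+ (w - y) Δ) (+-cong (trans (δ-- w y) (+-cong δw (-‿cong δy))) δΔ)) ⟩
        ⟦ ½ ⟧ * ((x * z - x * z) + 0#)        ≈⟨ *-congˡ (trans (+-identityʳ _) (-‿inverseʳ _)) ⟩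
        ⟦ ½ ⟧ * 0#                            ≈⟨ zeroʳ _ ⟩
        0#                                    ∎

      module _ (Z E : ℕ → Carrier)
               (Z₀ : Z 0 ≈ z) (E₀ : E 0 ≈ z)
               (Z-suc : ∀ n → Z (suc n) ≈ δ (Z n))
               (E-suc : ∀ n → E (suc n) ≈ δ (E n) + Δ * E n)
        where

        defect : ℕ → Carrier
        defect n = a * Z n - b * E n - K * exp α n

        δ-defect-expansion : ℕ → Carrier
        δ-defect-expansion n = ((x * z + x * z) * Z n + a * δ (Z n)) - ((x * z + x * z) * E n + b * δ (E n))
                               - ⟦ ℕ→ℚ 2 ⟧ * ((z * w) * Δ) * exp α n

        δ-defect : ∀ n → δ (defect n) ≈ δ-defect-expansion n
        δ-defect n = begin
          δ (a * Z n - b * E n - K * exp α n)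
            ≈⟨ trans (δ-- _ _) (+-congʳ (δ-- _ _)) ⟩
          δ (a * Z n) - δ (b * E n) - δ (K * exp α n)
            ≈⟨ +-cong (+-cong (leibniz a (Z n)) (-‿cong (leibniz b (E n)))) (-‿cong (leibniz K (exp α n))) ⟩
          (δ a * Z n + a * δ (Z n)) - (δ b * E n + b * δ (E n)) - (δ K * exp α n + K * δ (exp α n))
            ≈⟨ +-cong (+-cong (+-congʳ (*-congʳ δa)) (-‿cong (+-congʳ (*-congʳ δb))))
                      (-‿cong (trans (+-cong (*-congʳ δK) (trans (*-congˡ (δ-exp isDerivation δ-ℚ δα n)) (zeroʳ K))) (+-identityʳ _))) ⟩
          ((x * z + x * z) * Z n + a * δ (Z n)) - ((x * z + x * z) * E n + b * δ (E n)) - ⟦ ℕ→ℚ 2 ⟧ * ((z * w) * Δ) * exp α n ∎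

        defect-suc : ∀ n → defect (suc n) ≈ δ (defect n) + (- ⟦ ½ ⟧ * b) * defect n
        defect-suc n = begin
          a * Z (suc n) - b * E (suc n) - K * (α * exp α n)
            ≈⟨ +-congʳ (+-cong (*-congˡ (Z-suc n)) (-‿cong (*-congˡ (E-suc n)))) ⟩
          a * δ (Z n) - b * (δ (E n) + Δ * E n) - K * (α * exp α n)
            ≈⟨ solve 10 (λ x y z w Δ Z Z′ E E′ P →
                   ((w :+ y) :+ Δ) :* Z′ :- ((w :+ y) :- Δ) :* (E′ :+ Δ :* E) :- (con (ℕ→ℚ 2) :* (z :* Δ)) :* ((con ½ :* ((w :- y) :+ Δ)) :* P)
                := ((((x :* z :+ x :* z) :* Z :+ ((w :+ y) :+ Δ) :* Z′) :- ((x :* z :+ x :* z) :* E :+ ((w :+ y) :- Δ) :* E′))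
                      :- con (ℕ→ℚ 2) :* ((z :* w) :* Δ) :* P)
                   :+ (:- con ½ :* ((w :+ y) :- Δ)) :* (((w :+ y) :+ Δ) :* Z :- ((w :+ y) :- Δ) :* E :- (con (ℕ→ℚ 2) :* (z :* Δ)) :* P)
                   :+ con ½ :* (Z :- E) :* (((w :+ y) :* (w :+ y) :- con (ℕ→ℚ 4) :* (x :* z)) :- Δ :* Δ))
                refl x y z w Δ (Z n) (δ (Z n)) (E n) (δ (E n)) (exp α n) ⟩
          (δ-defect-expansion n + (- ⟦ ½ ⟧ * b) * defect n) + ⟦ ½ ⟧ * (Z n - E n) * (discriminant - Δ * Δ)
            ≈⟨ +-cong (+-congʳ (sym (δ-defect n))) (trans (*-congˡ (x≈y⇒x∙y⁻¹≈ε (sym Δ*Δ))) (zeroʳ _)) ⟩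
          (δ (defect n) + (- ⟦ ½ ⟧ * b) * defect n) + 0#
            ≈⟨ +-identityʳ _ ⟩
          δ (defect n) + (- ⟦ ½ ⟧ * b) * defect n ∎

        defect₀ : defect 0 ≈ 0#
        defect₀ = begin
          a * Z 0 - b * E 0 - K * 1#   ≈⟨ +-cong (+-cong (*-congˡ Z₀) (-‿cong (*-congˡ E₀))) (-‿cong (*-congˡ (sym 1-homo))) ⟩
          a * z - b * z - K * ⟦ ℚ.1ℚ ⟧ ≈⟨ solve 4 (λ z w y Δ → ((w :+ y) :+ Δ) :* z :- ((w :+ y) :- Δ) :* z :- (con (ℕ→ℚ 2) :* (z :* Δ)) :* con ℚ.1ℚ
                                                   := con ℚ.0ℚ) refl z w y Δ ⟩
          ⟦ ℚ.0ℚ ⟧                     ≈⟨ 0-homo ⟩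
          0#                           ∎

        grammar-identity : ∀ n → a * Z n - b * E n ≈ K * exp α n
        grammar-identity n = x∙y⁻¹≈ε⇒x≈y _ _ (recurrence-vanishes defect (- ⟦ ½ ⟧ * b) defect₀ defect-suc n)

      generating-function : ∀ (G : ℕ → Carrier) → G 0 ≈ z → (∀ n → G (suc n) ≈ δ (G n)) →
                            ∀ n → (G ⋆ (constant a ⊖ constant b ⋆ exp Δ)) n ≈ (constant K ⋆ exp α) n
      generating-function G G₀ G-suc n = begin
        (G ⋆ (constant a ⊖ constant b ⋆ exp Δ)) n
          ≈⟨ ⋆-distribˡ-⊖ G (constant a) (constant b ⋆ exp Δ) n ⟩
        (G ⋆ constant a) n - (G ⋆ (constant b ⋆ exp Δ)) n
          ≈⟨ +-cong (⋆-constant G a n) (-‿cong (trans (⋆-congʳ G n (λ j → constant-⋆ b (exp Δ) j)) (⋆-*ʳ G (exp Δ) b n))) ⟩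
        G n * a - b * E n
          ≈⟨ +-congʳ (*-comm (G n) a) ⟩
        a * G n - b * E n
          ≈⟨ grammar-identity G E G₀ E₀ G-suc E-suc n ⟩
        K * exp α n
          ≈⟨ constant-⋆ K (exp α) n ⟨
        (constant K ⋆ exp α) n ∎
        where
        E : ℕ → Carrier
        E = G ⋆ exp Δ
        E₀ : E 0 ≈ z
        E₀ = trans (*-congʳ (binomial-0 0)) (trans (*-identityˡ _) (trans (*-identityʳ (G 0)) G₀))
        E-suc : ∀ n → E (suc n) ≈ δ (E n) + Δ * E n
        E-suc n = begin
          E (suc n)                                        ≈⟨ ⋆-suc G (exp Δ) n ⟩
          ((G ∘ suc) ⋆ exp Δ) n + (G ⋆ (exp Δ ∘ suc)) n    ≈⟨ +-cong (⋆-congˡ (exp Δ) n G-suc) (⋆-*ʳ G (exp Δ) Δ n) ⟩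
          ((δ ∘ G) ⋆ exp Δ) n + Δ * E n                    ≈⟨ +-congʳ (δ-⋆ isDerivation δ-ℚ G (exp Δ) n (δ-exp isDerivation δ-ℚ δΔ)) ⟨
          δ (E n) + Δ * E n                                ∎

open Defs hiding (ℕ→ℚ)
open ≡ using (_≢_; refl; sym; trans; cong; cong₂; module ≡-Reasoning)

infix 4 _≟ᴹ_ _∣ᴹ?_

_≟ᴹ_ : DecidableEquality Mono
mono a b c d ≟ᴹ mono a′ b′ c′ d′ =
  map′ (λ { (refl , refl , refl , refl) → refl }) (λ { refl → refl , refl , refl , refl })
       (a ℕ.≟ a′ ×-dec b ℕ.≟ b′ ×-dec c ℕ.≟ c′ ×-dec d ℕ.≟ d′)

≟M≡does : ∀ m m′ → (m ≟M m′) ≡ does (m ≟ᴹ m′)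
≟M≡does (mono a b c d) (mono a′ b′ c′ d′)
  rewrite isYes≗does (a ℕ.≟ a′) | isYes≗does (b ℕ.≟ b′) | isYes≗does (c ℕ.≟ c′) | isYes≗does (d ℕ.≟ d′) = refl

mono-cong : ∀ {a b c d a′ b′ c′ d′} → a ≡ a′ → b ≡ b′ → c ≡ c′ → d ≡ d′ → mono a b c d ≡ mono a′ b′ c′ d′
mono-cong refl refl refl refl = refl

·M-comm : ∀ m m′ → m ·M m′ ≡ m′ ·M m
·M-comm (mono a b c d) (mono a′ b′ c′ d′) =
  mono-cong (ℕ.+-comm a a′) (ℕ.+-comm b b′) (ℕ.+-comm c c′) (ℕ.+-comm d d′)

·M-assoc : ∀ m m′ m″ → (m ·M m′) ·M m″ ≡ m ·M (m′ ·M m″)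
·M-assoc (mono a b c d) (mono a′ b′ c′ d′) (mono a″ b″ c″ d″) =
  mono-cong (ℕ.+-assoc a a′ a″) (ℕ.+-assoc b b′ b″) (ℕ.+-assoc c c′ c″) (ℕ.+-assoc d d′ d″)

·M-cancelˡ : ∀ m {m′ m″} → m ·M m′ ≡ m ·M m″ → m′ ≡ m″
·M-cancelˡ (mono a b c d) {mono _ _ _ _} {mono _ _ _ _} eq =
  mono-cong (ℕ.+-cancelˡ-≡ a _ _ (cong Mono.ex eq)) (ℕ.+-cancelˡ-≡ b _ _ (cong Mono.ey eq))
            (ℕ.+-cancelˡ-≡ c _ _ (cong Mono.ez eq)) (ℕ.+-cancelˡ-≡ d _ _ (cong Mono.ew eq))

_∣ᴹ?_ : ∀ m m′ → Dec (∃[ q ] m ·M q ≡ m′)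
mono a b c d ∣ᴹ? mono a′ b′ c′ d′ =
  map′ (λ (p , q , r , s) → mono (a′ ℕ.∸ a) (b′ ℕ.∸ b) (c′ ℕ.∸ c) (d′ ℕ.∸ d) ,
                            mono-cong (ℕ.m+[n∸m]≡n p) (ℕ.m+[n∸m]≡n q) (ℕ.m+[n∸m]≡n r) (ℕ.m+[n∸m]≡n s))
       (λ (q , eq) → ≤-of-+ (cong Mono.ex eq) , ≤-of-+ (cong Mono.ey eq) , ≤-of-+ (cong Mono.ez eq) , ≤-of-+ (cong Mono.ew eq))
       (a ℕ.≤? a′ ×-dec b ℕ.≤? b′ ×-dec c ℕ.≤? c′ ×-dec d ℕ.≤? d′)
  where
  ≤-of-+ : ∀ {m n k} → m ℕ.+ k ≡ n → m ≤ n
  ≤-of-+ {m} {k = k} refl = ℕ.m≤m+n m k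

term-coeff : ℚ → Mono → Mono → ℚ
term-coeff c m′ m = if does (m′ ≟ᴹ m) then c else 0ℚ

coeff-∷ : ∀ c m′ p m → coeff ((c , m′) ∷ p) m ≡ term-coeff c m′ m ℚ.+ coeff p m
coeff-∷ c m′ p m = cong (λ b → (if b then c else 0ℚ) ℚ.+ coeff p m) (≟M≡does m′ m)

coeff-[_] : ∀ t m → coeff [ t ] m ≡ term-coeff (proj₁ t) (proj₂ t) m
coeff-[ (c , m′) ] m = trans (coeff-∷ c m′ [] m) (ℚ.+-identityʳ _)

term-coeff-≡ : ∀ c m → term-coeff c m m ≡ c
term-coeff-≡ c m = cong (if_then c else 0ℚ) (dec-true (m ≟ᴹ m) refl)

term-coeff-≢ : ∀ c {m′ m} → m′ ≢ m → term-coeff c m′ m ≡ 0ℚ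
term-coeff-≢ c {m′} {m} m′≢m = cong (if_then c else 0ℚ) (dec-false (m′ ≟ᴹ m) m′≢m)

term-coeff-0 : ∀ m′ m → term-coeff 0ℚ m′ m ≡ 0ℚ
term-coeff-0 m′ m = if-same (does (m′ ≟ᴹ m))
  where
  if-same : ∀ b → (if b then 0ℚ else 0ℚ) ≡ 0ℚ
  if-same true  = refl
  if-same false = refl

term-coeff-+ : ∀ c c′ m′ m → term-coeff (c ℚ.+ c′) m′ m ≡ term-coeff c m′ m ℚ.+ term-coeff c′ m′ m
term-coeff-+ c c′ m′ m = if-+ (does (m′ ≟ᴹ m))
  where
  if-+ : ∀ b → (if b then c ℚ.+ c′ else 0ℚ) ≡ (if b then c else 0ℚ) ℚ.+ (if b then c′ else 0ℚ)
  if-+ true  = refl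
  if-+ false = refl

term-coeff-cong : ∀ c {m₁ m₂} m → (c ≢ 0ℚ → m₁ ≡ m₂) → term-coeff c m₁ m ≡ term-coeff c m₂ m
term-coeff-cong c {m₁} {m₂} m c≢0→m₁≡m₂ with c ℚ.≟ 0ℚ
... | yes refl = trans (term-coeff-0 m₁ m) (sym (term-coeff-0 m₂ m))
... | no c≢0   = cong (λ m′ → term-coeff c m′ m) (c≢0→m₁≡m₂ c≢0)

coeff-++ : ∀ p q m → coeff (p ++ q) m ≡ coeff p m ℚ.+ coeff q m
coeff-++ []             q m = sym (ℚ.+-identityˡ (coeff q m))
coeff-++ ((c , m′) ∷ p) q m =
  trans (cong (t ℚ.+_) (coeff-++ p q m)) (sym (ℚ.+-assoc t (coeff p m) (coeff q m)))
  where
  t : ℚ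
  t = if m′ ≟M m then c else 0ℚ

coeff-neg : ∀ p m → coeff (-P p) m ≡ ℚ.- coeff p m
coeff-neg []             m = refl
coeff-neg ((c , m′) ∷ p) m =
  trans (cong₂ ℚ._+_ (if-neg (m′ ≟M m)) (coeff-neg p m)) (sym (ℚ.neg-distrib-+ (if m′ ≟M m then c else 0ℚ) (coeff p m)))
  where
  if-neg : ∀ b → (if b then ℚ.- c else 0ℚ) ≡ ℚ.- (if b then c else 0ℚ)
  if-neg true  = refl
  if-neg false = refl

scale : ℚ × Mono → ℚ × Mono → ℚ × Mono
scale (c , m) (c′ , m′) = (c ℚ.* c′ , m ·M m′)

scale-assoc : ∀ t u v → scale (scale t u) v ≡ scale t (scale u v)
scale-assoc (c , m) (c′ , m′) (c″ , m″) = cong₂ _,_ (ℚ.*-assoc c c′ c″) (·M-assoc m m′ m″)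

scale-comm : ∀ t u → scale t u ≡ scale u t
scale-comm (c , m) (c′ , m′) = cong₂ _,_ (ℚ.*-comm c c′) (·M-comm m m′)

coeff-scale-∣ : ∀ c m₀ q {d m} → m₀ ·M d ≡ m → coeff (map (scale (c , m₀)) q) m ≡ c ℚ.* coeff q d
coeff-scale-∣ c m₀ []              _      = sym (ℚ.*-zeroʳ c)
coeff-scale-∣ c m₀ ((c′ , m′) ∷ q) {d} {m} m₀d≡m = begin
  coeff ((c ℚ.* c′ , m₀ ·M m′) ∷ map (scale (c , m₀)) q) m
    ≡⟨ coeff-∷ (c ℚ.* c′) (m₀ ·M m′) (map (scale (c , m₀)) q) m ⟩
  term-coeff (c ℚ.* c′) (m₀ ·M m′) m ℚ.+ coeff (map (scale (c , m₀)) q) m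
    ≡⟨ cong₂ ℚ._+_ term (coeff-scale-∣ c m₀ q m₀d≡m) ⟩
  c ℚ.* term-coeff c′ m′ d ℚ.+ c ℚ.* coeff q d
    ≡⟨ ℚ.*-distribˡ-+ c (term-coeff c′ m′ d) (coeff q d) ⟨
  c ℚ.* (term-coeff c′ m′ d ℚ.+ coeff q d)
    ≡⟨ cong (c ℚ.*_) (coeff-∷ c′ m′ q d) ⟨
  c ℚ.* coeff ((c′ , m′) ∷ q) d ∎
  where
  open ≡-Reasoning
  term : term-coeff (c ℚ.* c′) (m₀ ·M m′) m ≡ c ℚ.* term-coeff c′ m′ d
  term with m′ ≟ᴹ d
  ... | yes refl = begin
    term-coeff (c ℚ.* c′) (m₀ ·M m′) m           ≡⟨ cong (term-coeff (c ℚ.* c′) (m₀ ·M m′)) m₀d≡m ⟨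
    term-coeff (c ℚ.* c′) (m₀ ·M m′) (m₀ ·M m′)  ≡⟨ term-coeff-≡ (c ℚ.* c′) (m₀ ·M m′) ⟩
    c ℚ.* c′                                     ≡⟨ cong (c ℚ.*_) (term-coeff-≡ c′ m′) ⟨
    c ℚ.* term-coeff c′ m′ m′                    ∎
  ... | no m′≢d  = begin
    term-coeff (c ℚ.* c′) (m₀ ·M m′) m  ≡⟨ term-coeff-≢ (c ℚ.* c′) (λ eq → m′≢d (·M-cancelˡ m₀ (trans eq (sym m₀d≡m)))) ⟩
    0ℚ                                  ≡⟨ ℚ.*-zeroʳ c ⟨
    c ℚ.* 0ℚ                            ≡⟨ cong (c ℚ.*_) (term-coeff-≢ c′ m′≢d) ⟨
    c ℚ.* term-coeff c′ m′ d            ∎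

coeff-scale-∤ : ∀ c m₀ q {m} → ¬ (∃[ d ] m₀ ·M d ≡ m) → coeff (map (scale (c , m₀)) q) m ≡ 0ℚ
coeff-scale-∤ c m₀ []              _         = refl
coeff-scale-∤ c m₀ ((c′ , m′) ∷ q) {m} m₀∤m = begin
  coeff ((c ℚ.* c′ , m₀ ·M m′) ∷ map (scale (c , m₀)) q) m
    ≡⟨ coeff-∷ (c ℚ.* c′) (m₀ ·M m′) (map (scale (c , m₀)) q) m ⟩
  term-coeff (c ℚ.* c′) (m₀ ·M m′) m ℚ.+ coeff (map (scale (c , m₀)) q) m
    ≡⟨ cong₂ ℚ._+_ (term-coeff-≢ (c ℚ.* c′) (λ eq → m₀∤m (m′ , eq))) (coeff-scale-∤ c m₀ q m₀∤m) ⟩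
  0ℚ ℚ.+ 0ℚ
    ≡⟨ ℚ.+-identityˡ 0ℚ ⟩
  0ℚ ∎
  where open ≡-Reasoning

-- A record rather than _≈P_ itself, so that a proof determines the two polynomials.
infix 4 _≃_
record _≃_ (p q : Pol) : Set where
  constructor coeffwise
  field coeff-≡ : p ≈P q
open _≃_

≃-reflexive : ∀ {p q} → p ≡ q → p ≃ q
≃-reflexive refl = coeffwise (λ _ → refl)

module ℚ+ = Algebra.Properties.CommutativeSemigroup (CommutativeMonoid.commutativeSemigroup ℚ.+-0-commutativeMonoid)

+P-cong : ∀ {p p′ q q′} → p ≃ p′ → q ≃ q′ → (p +P q) ≃ (p′ +P q′)
+P-cong {p} {p′} {q} {q′} (coeffwise p≈p′) (coeffwise q≈q′) = coeffwise λ m →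
  trans (coeff-++ p q m) (trans (cong₂ ℚ._+_ (p≈p′ m) (q≈q′ m)) (sym (coeff-++ p′ q′ m)))

+P-comm : ∀ p q → (p +P q) ≃ (q +P p)
+P-comm p q = coeffwise λ m → trans (coeff-++ p q m) (trans (ℚ.+-comm (coeff p m) (coeff q m)) (sym (coeff-++ q p m)))

-P-cong : ∀ {p q} → p ≃ q → (-P p) ≃ (-P q)
-P-cong {p} {q} (coeffwise p≈q) = coeffwise λ m → trans (coeff-neg p m) (trans (cong ℚ.-_ (p≈q m)) (sym (coeff-neg q m)))

-P-inverseˡ : ∀ p → ((-P p) +P p) ≃ 0P
-P-inverseˡ p = coeffwise λ m →
  trans (coeff-++ (-P p) p m) (trans (cong (ℚ._+ coeff p m) (coeff-neg p m)) (ℚ.+-inverseˡ (coeff p m)))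

-P-inverseʳ : ∀ p → (p +P (-P p)) ≃ 0P
-P-inverseʳ p = coeffwise λ m →
  trans (coeff-++ p (-P p) m) (trans (cong (coeff p m ℚ.+_) (coeff-neg p m)) (ℚ.+-inverseʳ (coeff p m)))

map-scale-cong : ∀ t {q q′} → q ≈P q′ → map (scale t) q ≈P map (scale t) q′
map-scale-cong (c , m₀) {q} {q′} q≈q′ m with m₀ ∣ᴹ? m
... | yes (d , m₀d≡m) = begin
  coeff (map (scale (c , m₀)) q) m   ≡⟨ coeff-scale-∣ c m₀ q m₀d≡m ⟩
  c ℚ.* coeff q d                    ≡⟨ cong (c ℚ.*_) (q≈q′ d) ⟩
  c ℚ.* coeff q′ d                   ≡⟨ coeff-scale-∣ c m₀ q′ m₀d≡m ⟨
  coeff (map (scale (c , m₀)) q′) m  ∎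
  where open ≡-Reasoning
... | no m₀∤m = trans (coeff-scale-∤ c m₀ q m₀∤m) (sym (coeff-scale-∤ c m₀ q′ m₀∤m))

*P-distribʳ : ∀ p p′ q → ((p ++ p′) *P q) ≡ ((p *P q) ++ (p′ *P q))
*P-distribʳ []      p′ q = refl
*P-distribʳ (t ∷ p) p′ q =
  trans (cong (map (scale t) q ++_) (*P-distribʳ p p′ q)) (sym (List.++-assoc (map (scale t) q) (p *P q) (p′ *P q)))

*P-distribˡ : ∀ p q r → (p *P (q ++ r)) ≈P ((p *P q) ++ (p *P r))
*P-distribˡ []      q r m = refl
*P-distribˡ (t ∷ p) q r m = begin
  coeff (map (scale t) (q ++ r) ++ (p *P (q ++ r))) m
    ≡⟨ coeff-++ (map (scale t) (q ++ r)) (p *P (q ++ r)) m ⟩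
  coeff (map (scale t) (q ++ r)) m ℚ.+ coeff (p *P (q ++ r)) m
    ≡⟨ cong₂ ℚ._+_ (trans (cong (λ l → coeff l m) (List.map-++ (scale t) q r)) (coeff-++ (map (scale t) q) (map (scale t) r) m))
                   (trans (*P-distribˡ p q r m) (coeff-++ (p *P q) (p *P r) m)) ⟩
  (tq ℚ.+ tr) ℚ.+ (pq ℚ.+ pr)
    ≡⟨ ℚ+.interchange tq tr pq pr ⟩
  (tq ℚ.+ pq) ℚ.+ (tr ℚ.+ pr)
    ≡⟨ cong₂ ℚ._+_ (coeff-++ (map (scale t) q) (p *P q) m) (coeff-++ (map (scale t) r) (p *P r) m) ⟨
  coeff ((t ∷ p) *P q) m ℚ.+ coeff ((t ∷ p) *P r) m
    ≡⟨ coeff-++ ((t ∷ p) *P q) ((t ∷ p) *P r) m ⟨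
  coeff (((t ∷ p) *P q) ++ ((t ∷ p) *P r)) m ∎
  where
  open ≡-Reasoning
  tq tr pq pr : ℚ
  tq = coeff (map (scale t) q) m
  tr = coeff (map (scale t) r) m
  pq = coeff (p *P q) m
  pr = coeff (p *P r) m

map-scale-*P : ∀ t q r → (map (scale t) q *P r) ≡ map (scale t) (q *P r)
map-scale-*P t []      r = refl
map-scale-*P t (u ∷ q) r = begin
  map (scale (scale t u)) r ++ (map (scale t) q *P r)
    ≡⟨ cong₂ _++_ (trans (List.map-cong (scale-assoc t u) r) (List.map-∘ r)) (map-scale-*P t q r) ⟩
  map (scale t) (map (scale u) r) ++ map (scale t) (q *P r)
    ≡⟨ List.map-++ (scale t) (map (scale u) r) (q *P r) ⟨
  map (scale t) (map (scale u) r ++ (q *P r)) ∎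
  where open ≡-Reasoning

*P-assoc : ∀ p q r → ((p *P q) *P r) ≡ (p *P (q *P r))
*P-assoc []      q r = refl
*P-assoc (t ∷ p) q r = begin
  (map (scale t) q ++ (p *P q)) *P r          ≡⟨ *P-distribʳ (map (scale t) q) (p *P q) r ⟩
  (map (scale t) q *P r) ++ ((p *P q) *P r)   ≡⟨ cong₂ _++_ (map-scale-*P t q r) (*P-assoc p q r) ⟩
  map (scale t) (q *P r) ++ (p *P (q *P r))   ∎
  where open ≡-Reasoning

*P-zeroʳ : ∀ p → (p *P []) ≡ []
*P-zeroʳ []      = refl
*P-zeroʳ (t ∷ p) = *P-zeroʳ p

coeff-*P-∷ʳ : ∀ q t p m → coeff (q *P (t ∷ p)) m ≡ coeff (map (scale t) q) m ℚ.+ coeff (q *P p) m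
coeff-*P-∷ʳ []      t p m = sym (ℚ.+-identityˡ 0ℚ)
coeff-*P-∷ʳ (u ∷ q) t p m = begin
  coeff ((scale u t ∷ map (scale u) p) ++ (q *P (t ∷ p))) m
    ≡⟨ cong (λ v → coeff ((v ∷ map (scale u) p) ++ (q *P (t ∷ p))) m) (scale-comm u t) ⟩
  coeff ([ scale t u ] ++ map (scale u) p ++ (q *P (t ∷ p))) m
    ≡⟨ coeff-++ [ scale t u ] (map (scale u) p ++ (q *P (t ∷ p))) m ⟩
  T ℚ.+ coeff (map (scale u) p ++ (q *P (t ∷ p))) m
    ≡⟨ cong (T ℚ.+_) (trans (coeff-++ (map (scale u) p) (q *P (t ∷ p)) m) (cong (A ℚ.+_) (coeff-*P-∷ʳ q t p m))) ⟩
  T ℚ.+ (A ℚ.+ (B ℚ.+ C))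
    ≡⟨ cong (T ℚ.+_) (ℚ+.x∙yz≈y∙xz A B C) ⟩
  T ℚ.+ (B ℚ.+ (A ℚ.+ C))
    ≡⟨ ℚ.+-assoc T B (A ℚ.+ C) ⟨
  (T ℚ.+ B) ℚ.+ (A ℚ.+ C)
    ≡⟨ cong₂ ℚ._+_ (coeff-++ [ scale t u ] (map (scale t) q) m) (coeff-++ (map (scale u) p) (q *P p) m) ⟨
  coeff (map (scale t) (u ∷ q)) m ℚ.+ coeff ((u ∷ q) *P p) m ∎
  where
  open ≡-Reasoning
  T A B C : ℚ
  T = coeff [ scale t u ] m
  A = coeff (map (scale u) p) m
  B = coeff (map (scale t) q) m
  C = coeff (q *P p) m

*P-comm : ∀ p q → (p *P q) ≈P (q *P p)
*P-comm []      q m = cong (λ l → coeff l m) (sym (*P-zeroʳ q))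
*P-comm (t ∷ p) q m = begin
  coeff (map (scale t) q ++ (p *P q)) m           ≡⟨ coeff-++ (map (scale t) q) (p *P q) m ⟩
  coeff (map (scale t) q) m ℚ.+ coeff (p *P q) m  ≡⟨ cong (coeff (map (scale t) q) m ℚ.+_) (*P-comm p q m) ⟩
  coeff (map (scale t) q) m ℚ.+ coeff (q *P p) m  ≡⟨ coeff-*P-∷ʳ q t p m ⟨
  coeff (q *P (t ∷ p)) m                          ∎
  where open ≡-Reasoning

*P-congʳ : ∀ p {q q′} → q ≈P q′ → (p *P q) ≈P (p *P q′)
*P-congʳ []      q≈q′ m = refl
*P-congʳ (t ∷ p) {q} {q′} q≈q′ m = begin
  coeff (map (scale t) q ++ (p *P q)) m             ≡⟨ coeff-++ (map (scale t) q) (p *P q) m ⟩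
  coeff (map (scale t) q) m ℚ.+ coeff (p *P q) m    ≡⟨ cong₂ ℚ._+_ (map-scale-cong t {q} {q′} q≈q′ m) (*P-congʳ p {q} {q′} q≈q′ m) ⟩
  coeff (map (scale t) q′) m ℚ.+ coeff (p *P q′) m  ≡⟨ coeff-++ (map (scale t) q′) (p *P q′) m ⟨
  coeff (map (scale t) q′ ++ (p *P q′)) m           ∎
  where open ≡-Reasoning

*P-cong : ∀ {p p′ q q′} → p ≃ p′ → q ≃ q′ → (p *P q) ≃ (p′ *P q′)
*P-cong {p} {p′} {q} {q′} (coeffwise p≈p′) (coeffwise q≈q′) = coeffwise λ m →
  trans (*P-congʳ p {q} {q′} q≈q′ m) (trans (*P-comm p q′ m) (trans (*P-congʳ q′ {p} {p′} p≈p′ m) (*P-comm q′ p′ m)))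

*P-identityˡ : ∀ p → (1P *P p) ≡ p
*P-identityˡ p = trans (List.++-identityʳ _) (trans (List.map-cong scale-1 p) (List.map-id p))
  where
  scale-1 : ∀ u → scale (1ℚ , mono 0 0 0 0) u ≡ u
  scale-1 (c , m) = cong (_, m) (ℚ.*-identityˡ c)

Pol-ring : CommutativeRing 0ℓ 0ℓ
Pol-ring = record
  { Carrier = Pol
  ; _≈_ = _≃_
  ; _+_ = _+P_
  ; _*_ = _*P_
  ; -_ = -P_
  ; 0# = 0P
  ; 1# = 1P
  ; isCommutativeRing = record
    { isRing = record
      { +-isAbelianGroup = record
        { isGroup = record
          { isMonoid = record
            { isSemigroup = record
              { isMagma = record
                { isEquivalence = record
                  { refl  = coeffwise (λ _ → refl)
                  ; sym   = λ (coeffwise p) → coeffwise (λ m → sym (p m))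
                  ; trans = λ (coeffwise p) (coeffwise q) → coeffwise (λ m → trans (p m) (q m)) }
                ; ∙-cong = +P-cong }
              ; assoc = λ p q r → ≃-reflexive (List.++-assoc p q r) }
            ; identity = (λ _ → coeffwise (λ _ → refl)) , (λ p → ≃-reflexive (List.++-identityʳ p)) }
          ; inverse = -P-inverseˡ , -P-inverseʳ
          ; ⁻¹-cong = -P-cong }
        ; comm = +P-comm }
      ; *-cong = *P-cong
      ; *-assoc = λ p q r → ≃-reflexive (*P-assoc p q r)
      ; *-identity = (λ p → ≃-reflexive (*P-identityˡ p))
                   , (λ p → coeffwise λ m → trans (*P-comm p 1P m) (cong (λ l → coeff l m) (*P-identityˡ p)))
      ; distrib = (λ p q r → coeffwise (*P-distribˡ p q r)) , (λ p q r → ≃-reflexive (*P-distribʳ q r p)) }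
    ; *-comm = λ p q → coeffwise (*P-comm p q) } }

module Pol = CommutativeRing Pol-ring

cst-morphism : ℚ.+-*-rawRing -Raw-AlmostCommutative⟶ fromCommutativeRing Pol-ring
cst-morphism = record
  { ⟦_⟧    = cst
  ; +-homo = λ c c′ → coeffwise λ m → begin
      coeff (cst (c ℚ.+ c′)) m                 ≡⟨ coeff-[ (c ℚ.+ c′ , mono 0 0 0 0) ] m ⟩
      term-coeff (c ℚ.+ c′) (mono 0 0 0 0) m   ≡⟨ term-coeff-+ c c′ (mono 0 0 0 0) m ⟩
      term-coeff c (mono 0 0 0 0) m ℚ.+ term-coeff c′ (mono 0 0 0 0) m
        ≡⟨ cong₂ ℚ._+_ (coeff-[ (c , mono 0 0 0 0) ] m) (coeff-[ (c′ , mono 0 0 0 0) ] m) ⟨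
      coeff (cst c) m ℚ.+ coeff (cst c′) m     ≡⟨ coeff-++ (cst c) (cst c′) m ⟨
      coeff (cst c +P cst c′) m                ∎
  ; *-homo = λ _ _ → coeffwise λ _ → refl
  ; -‿homo = λ _ → coeffwise λ _ → refl
  ; 0-homo = coeffwise λ m → trans (coeff-[ (0ℚ , mono 0 0 0 0) ] m) (term-coeff-0 (mono 0 0 0 0) m)
  ; 1-homo = coeffwise λ _ → refl
  }
  where open ≡-Reasoning

-- Partial derivatives and the formal derivative D

data Variable : Set where
  X Y Z W : Variable

degree : Variable → Mono → ℕ
degree X = Mono.ex
degree Y = Mono.ey
degree Z = Mono.ez
degree W = Mono.ew

lower raise : Variable → Mono → Mono
lower X (mono a b c d) = mono (a ℕ.∸ 1) b c d
lower Y (mono a b c d) = mono a (b ℕ.∸ 1) c d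
lower Z (mono a b c d) = mono a b (c ℕ.∸ 1) d
lower W (mono a b c d) = mono a b c (d ℕ.∸ 1)
raise X (mono a b c d) = mono (suc a) b c d
raise Y (mono a b c d) = mono a (suc b) c d
raise Z (mono a b c d) = mono a b (suc c) d
raise W (mono a b c d) = mono a b c (suc d)

degree-raise : ∀ v m → degree v (raise v m) ≡ suc (degree v m)
degree-raise X m = refl
degree-raise Y m = refl
degree-raise Z m = refl
degree-raise W m = refl

lower-raise : ∀ v m → lower v (raise v m) ≡ m
lower-raise X m = refl
lower-raise Y m = refl
lower-raise Z m = refl
lower-raise W m = refl

raise-lower : ∀ v m → degree v m ≢ 0 → raise v (lower v m) ≡ m
raise-lower X (mono (suc a) b c d) _ = refl
raise-lower Y (mono a (suc b) c d) _ = refl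
raise-lower Z (mono a b (suc c) d) _ = refl
raise-lower W (mono a b c (suc d)) _ = refl
raise-lower X (mono zero b c d) a≢0 = contradiction refl a≢0
raise-lower Y (mono a zero c d) b≢0 = contradiction refl b≢0
raise-lower Z (mono a b zero d) c≢0 = contradiction refl c≢0
raise-lower W (mono a b c zero) d≢0 = contradiction refl d≢0

degree-· : ∀ v m m′ → degree v (m ·M m′) ≡ degree v m ℕ.+ degree v m′
degree-· X m m′ = refl
degree-· Y m m′ = refl
degree-· Z m m′ = refl
degree-· W m m′ = refl

lower-·ˡ : ∀ v m m′ → degree v m ≢ 0 → lower v (m ·M m′) ≡ lower v m ·M m′
lower-·ˡ X (mono (suc a) b c d) m′ _ = refl
lower-·ˡ Y (mono a (suc b) c d) m′ _ = refl
lower-·ˡ Z (mono a b (suc c) d) m′ _ = refl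
lower-·ˡ W (mono a b c (suc d)) m′ _ = refl
lower-·ˡ X (mono zero b c d) m′ a≢0 = contradiction refl a≢0
lower-·ˡ Y (mono a zero c d) m′ b≢0 = contradiction refl b≢0
lower-·ˡ Z (mono a b zero d) m′ c≢0 = contradiction refl c≢0
lower-·ˡ W (mono a b c zero) m′ d≢0 = contradiction refl d≢0

lower-·ʳ : ∀ v m m′ → degree v m′ ≢ 0 → lower v (m ·M m′) ≡ m ·M lower v m′
lower-·ʳ v m m′ d≢0 = begin
  lower v (m ·M m′)   ≡⟨ cong (lower v) (·M-comm m m′) ⟩
  lower v (m′ ·M m)   ≡⟨ lower-·ˡ v m′ m d≢0 ⟩
  lower v m′ ·M m     ≡⟨ ·M-comm (lower v m′) m ⟩
  m ·M lower v m′     ∎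
  where open ≡-Reasoning

∂-term : Variable → ℚ × Mono → ℚ × Mono
∂-term v (c , m) = (c ℚ.* ℕ→ℚ (degree v m) , lower v m)

∂ : Variable → Pol → Pol
∂ v = map (∂-term v)

coeff-∂ : ∀ v p m → coeff (∂ v p) m ≡ ℕ→ℚ (suc (degree v m)) ℚ.* coeff p (raise v m)
coeff-∂ v []             m = sym (ℚ.*-zeroʳ (ℕ→ℚ (suc (degree v m))))
coeff-∂ v ((c , m′) ∷ p) m = begin
  coeff (∂-term v (c , m′) ∷ ∂ v p) m
    ≡⟨ coeff-∷ (c ℚ.* ℕ→ℚ (degree v m′)) (lower v m′) (∂ v p) m ⟩
  term-coeff (c ℚ.* ℕ→ℚ (degree v m′)) (lower v m′) m ℚ.+ coeff (∂ v p) m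
    ≡⟨ cong₂ ℚ._+_ term (coeff-∂ v p m) ⟩
  k ℚ.* term-coeff c m′ (raise v m) ℚ.+ k ℚ.* coeff p (raise v m)
    ≡⟨ ℚ.*-distribˡ-+ k (term-coeff c m′ (raise v m)) (coeff p (raise v m)) ⟨
  k ℚ.* (term-coeff c m′ (raise v m) ℚ.+ coeff p (raise v m))
    ≡⟨ cong (k ℚ.*_) (coeff-∷ c m′ p (raise v m)) ⟨
  k ℚ.* coeff ((c , m′) ∷ p) (raise v m) ∎
  where
  open ≡-Reasoning
  k : ℚ
  k = ℕ→ℚ (suc (degree v m))
  term : term-coeff (c ℚ.* ℕ→ℚ (degree v m′)) (lower v m′) m ≡ k ℚ.* term-coeff c m′ (raise v m)
  term with m′ ≟ᴹ raise v m
  ... | yes refl = begin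
    term-coeff (c ℚ.* ℕ→ℚ (degree v (raise v m))) (lower v (raise v m)) m
      ≡⟨ cong₂ (λ d m″ → term-coeff (c ℚ.* ℕ→ℚ d) m″ m) (degree-raise v m) (lower-raise v m) ⟩
    term-coeff (c ℚ.* k) m m      ≡⟨ term-coeff-≡ (c ℚ.* k) m ⟩
    c ℚ.* k                       ≡⟨ ℚ.*-comm c k ⟩
    k ℚ.* c                       ≡⟨ cong (k ℚ.*_) (term-coeff-≡ c (raise v m)) ⟨
    k ℚ.* term-coeff c (raise v m) (raise v m) ∎
  ... | no m′≢raise = begin
    term-coeff (c ℚ.* ℕ→ℚ (degree v m′)) (lower v m′) m  ≡⟨ vanishes ⟩
    0ℚ                                                   ≡⟨ ℚ.*-zeroʳ k ⟨
    k ℚ.* 0ℚ                                             ≡⟨ cong (k ℚ.*_) (term-coeff-≢ c m′≢raise) ⟨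
    k ℚ.* term-coeff c m′ (raise v m)                    ∎
    where
    vanishes : term-coeff (c ℚ.* ℕ→ℚ (degree v m′)) (lower v m′) m ≡ 0ℚ
    vanishes with degree v m′ ℕ.≟ 0
    ... | yes d≡0 = trans (cong (λ q → term-coeff q (lower v m′) m) (trans (cong (λ d → c ℚ.* ℕ→ℚ d) d≡0) (ℚ.*-zeroʳ c)))
                          (term-coeff-0 (lower v m′) m)
    ... | no d≢0  = term-coeff-≢ _ (λ eq → m′≢raise (trans (sym (raise-lower v m′ d≢0)) (cong (raise v) eq)))

∂-cong : ∀ v {p q} → p ≃ q → ∂ v p ≃ ∂ v q
∂-cong v {p} {q} (coeffwise p≈q) = coeffwise λ m →
  trans (coeff-∂ v p m) (trans (cong (ℕ→ℚ (suc (degree v m)) ℚ.*_) (p≈q (raise v m))) (sym (coeff-∂ v q m)))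

single-split : ∀ c c′ {m₀ m₁ m₂} → (c ≢ 0ℚ → m₀ ≡ m₁) → (c′ ≢ 0ℚ → m₀ ≡ m₂) →
               [ (c ℚ.+ c′ , m₀) ] ≃ (c , m₁) ∷ (c′ , m₂) ∷ []
single-split c c′ {m₀} {m₁} {m₂} c≢0→m₀≡m₁ c′≢0→m₀≡m₂ = coeffwise λ m → begin
  coeff [ (c ℚ.+ c′ , m₀) ] m                          ≡⟨ coeff-[ (c ℚ.+ c′ , m₀) ] m ⟩
  term-coeff (c ℚ.+ c′) m₀ m                           ≡⟨ term-coeff-+ c c′ m₀ m ⟩
  term-coeff c m₀ m ℚ.+ term-coeff c′ m₀ m             ≡⟨ cong₂ ℚ._+_ (term-coeff-cong c m c≢0→m₀≡m₁) (term-coeff-cong c′ m c′≢0→m₀≡m₂) ⟩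
  term-coeff c m₁ m ℚ.+ term-coeff c′ m₂ m             ≡⟨ cong (term-coeff c m₁ m ℚ.+_) (coeff-[ (c′ , m₂) ] m) ⟨
  term-coeff c m₁ m ℚ.+ coeff [ (c′ , m₂) ] m          ≡⟨ coeff-∷ c m₁ [ (c′ , m₂) ] m ⟨
  coeff ((c , m₁) ∷ (c′ , m₂) ∷ []) m                  ∎
  where open ≡-Reasoning

module TermwiseLeibniz
  (f : ℚ × Mono → ℚ × Mono)
  (f-scale : ∀ t u → [ f (scale t u) ] ≃ scale (f t) u ∷ scale t (f u) ∷ [])
  where

  open CommutativeRing Pol-ring using (+-cong; +-commutativeSemigroup; setoid)
  open import Algebra.Properties.CommutativeSemigroup +-commutativeSemigroup using (interchange)
  open import Relation.Binary.Reasoning.Setoid setoid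

  map-scale : ∀ t q → map f (map (scale t) q) ≃ map (scale (f t)) q ++ map (scale t) (map f q)
  map-scale t []      = coeffwise λ _ → refl
  map-scale t (u ∷ q) = begin
    [ f (scale t u) ] ++ map f (map (scale t) q)
      ≈⟨ +-cong (f-scale t u) (map-scale t q) ⟩
    ([ scale (f t) u ] ++ [ scale t (f u) ]) ++ (map (scale (f t)) q ++ map (scale t) (map f q))
      ≈⟨ interchange [ scale (f t) u ] [ scale t (f u) ] (map (scale (f t)) q) (map (scale t) (map f q)) ⟩
    ([ scale (f t) u ] ++ map (scale (f t)) q) ++ ([ scale t (f u) ] ++ map (scale t) (map f q)) ∎

  map-leibniz : ∀ p q → map f (p *P q) ≃ (map f p *P q) ++ (p *P map f q)
  map-leibniz []      q = coeffwise λ _ → refl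
  map-leibniz (t ∷ p) q = begin
    map f (map (scale t) q ++ (p *P q))
      ≡⟨ List.map-++ f (map (scale t) q) (p *P q) ⟩
    map f (map (scale t) q) ++ map f (p *P q)
      ≈⟨ +-cong (map-scale t q) (map-leibniz p q) ⟩
    (map (scale (f t)) q ++ map (scale t) (map f q)) ++ ((map f p *P q) ++ (p *P map f q))
      ≈⟨ interchange (map (scale (f t)) q) (map (scale t) (map f q)) (map f p *P q) (p *P map f q) ⟩
    (map (scale (f t)) q ++ (map f p *P q)) ++ (map (scale t) (map f q) ++ (p *P map f q)) ∎

module ℚ-Arithmetic = ℚ-Solver ℚ.+-*-commutativeRing (-raw-almostCommutative⟶ (fromCommutativeRing ℚ.+-*-commutativeRing))

∂-term-scale : ∀ v t u → [ ∂-term v (scale t u) ] ≃ scale (∂-term v t) u ∷ scale t (∂-term v u) ∷ []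
∂-term-scale v (c , m) (c′ , m′) = Pol.trans (≃-reflexive (cong (λ k → [ (k , lower v (m ·M m′)) ]) coefficient))
  (single-split ((c ℚ.* d) ℚ.* c′) (c ℚ.* (c′ ℚ.* d′))
     (λ left≢0 → lower-·ˡ v m m′ (λ d≡0 → left≢0 (vanish-left d≡0)))
     (λ right≢0 → lower-·ʳ v m m′ (λ d≡0 → right≢0 (vanish-right d≡0))))
  where
  open ℚ-Arithmetic using (solve; _:=_; _:+_; _:*_)
  d d′ : ℚ
  d  = ℕ→ℚ (degree v m)
  d′ = ℕ→ℚ (degree v m′)
  coefficient : (c ℚ.* c′) ℚ.* ℕ→ℚ (degree v (m ·M m′)) ≡ (c ℚ.* d) ℚ.* c′ ℚ.+ c ℚ.* (c′ ℚ.* d′)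
  coefficient = trans (cong (λ k → (c ℚ.* c′) ℚ.* ℕ→ℚ k) (degree-· v m m′))
    (trans (cong ((c ℚ.* c′) ℚ.*_) (ℕ→ℚ-+ (degree v m) (degree v m′)))
           (solve 4 (λ c c′ d d′ → (c :* c′) :* (d :+ d′) := (c :* d) :* c′ :+ c :* (c′ :* d′)) refl c c′ d d′))
  vanish-left : degree v m ≡ 0 → (c ℚ.* d) ℚ.* c′ ≡ 0ℚ
  vanish-left d≡0 = trans (cong (λ k → (c ℚ.* ℕ→ℚ k) ℚ.* c′) d≡0) (trans (cong (ℚ._* c′) (ℚ.*-zeroʳ c)) (ℚ.*-zeroˡ c′))
  vanish-right : degree v m′ ≡ 0 → c ℚ.* (c′ ℚ.* d′) ≡ 0ℚ
  vanish-right d≡0 = trans (cong (λ k → c ℚ.* (c′ ℚ.* ℕ→ℚ k)) d≡0) (trans (cong (c ℚ.*_) (ℚ.*-zeroʳ c′)) (ℚ.*-zeroʳ c))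

∂-leibniz : ∀ v p q → ∂ v (p *P q) ≃ (∂ v p *P q) +P (p *P ∂ v q)
∂-leibniz v = TermwiseLeibniz.map-leibniz (∂-term v) (∂-term-scale v)

rule : Variable → Pol
rule X = varx *P vary
rule Y = varx *P varz
rule Z = varz *P varw
rule W = varx *P varz

D∂ : Pol → Pol
D∂ p = (rule X *P ∂ X p) +P ((rule Y *P ∂ Y p) +P ((rule Z *P ∂ Z p) +P (rule W *P ∂ W p)))

module Pol-Solver = Algebra.Solver.Ring.NaturalCoefficients.Default Pol.commutativeSemiring

D∂-∷ : ∀ t p → D∂ (t ∷ p) ≃ D∂ [ t ] +P D∂ p
D∂-∷ t p = solve 12 (λ gx gy gz gw ax ay az aw bx by bz bw →
    gx :* (ax :+ bx) :+ (gy :* (ay :+ by) :+ (gz :* (az :+ bz) :+ gw :* (aw :+ bw)))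
 := (gx :* ax :+ (gy :* ay :+ (gz :* az :+ gw :* aw))) :+ (gx :* bx :+ (gy :* by :+ (gz :* bz :+ gw :* bw))))
  Pol.refl (rule X) (rule Y) (rule Z) (rule W) (∂ X [ t ]) (∂ Y [ t ]) (∂ Z [ t ]) (∂ W [ t ]) (∂ X p) (∂ Y p) (∂ Z p) (∂ W p)
  where open Pol-Solver using (solve; _:=_; _:+_; _:*_)

[]-cong : ∀ {c c′ m m′} → c ≡ c′ → (c ≢ 0ℚ → m ≡ m′) → [ (c , m) ] ≃ [ (c′ , m′) ]
[]-cong {c} {_} {m} {m′} refl c≢0→m≡m′ = coeffwise λ k →
  trans (coeff-[ (c , m) ] k) (trans (term-coeff-cong c k c≢0→m≡m′) (sym (coeff-[ (c , m′) ] k)))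

suc-pred-of-nonzero : ∀ k a → k ℚ.* ℕ→ℚ a ≢ 0ℚ → a ≡ suc (a ℕ.∸ 1)
suc-pred-of-nonzero k zero    ka≢0 = contradiction (ℚ.*-zeroʳ k) ka≢0
suc-pred-of-nonzero k (suc a) _    = refl

-- The monomials differ only when a zero exponent meets truncated subtraction, and then the coefficient is 0.
Dmono≃D∂ : ∀ k m → Dmono k m ≃ D∂ [ (k , m) ]
Dmono≃D∂ k (mono a b c d) =
  Pol.+-cong ([]-cong (sym (ℚ.*-identityˡ _)) (λ ka≢0 → cong (λ a′ → mono a′ (suc b) c d) (suc-pred-of-nonzero k a ka≢0))) (
  Pol.+-cong ([]-cong (sym (ℚ.*-identityˡ _)) (λ _ → refl)) (
  Pol.+-cong ([]-cong (sym (ℚ.*-identityˡ _)) (λ kc≢0 → cong (λ c′ → mono a b c′ (suc d)) (suc-pred-of-nonzero k c kc≢0)))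
             ([]-cong (sym (ℚ.*-identityˡ _)) (λ _ → refl))))

D≃D∂ : ∀ p → D p ≃ D∂ p
D≃D∂ []            = Pol.refl
D≃D∂ ((k , m) ∷ p) = Pol.trans (Pol.+-cong (Dmono≃D∂ k m) (D≃D∂ p)) (Pol.sym (D∂-∷ (k , m) p))

D∂-cong : ∀ {p q} → p ≃ q → D∂ p ≃ D∂ q
D∂-cong p≃q = Pol.+-cong (Pol.*-congˡ {rule X} (∂-cong X p≃q)) (Pol.+-cong (Pol.*-congˡ {rule Y} (∂-cong Y p≃q))
               (Pol.+-cong (Pol.*-congˡ {rule Z} (∂-cong Z p≃q)) (Pol.*-congˡ {rule W} (∂-cong W p≃q))))

D-++ : ∀ p q → D (p ++ q) ≡ D p ++ D q
D-++ []            q = refl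
D-++ ((k , m) ∷ p) q = trans (cong (Dmono k m ++_) (D-++ p q)) (sym (List.++-assoc (Dmono k m) (D p) (D q)))

D-isDerivation : IsDerivation Pol-ring D
D-isDerivation = record
  { δ-cong  = λ {p} {q} p≃q → Pol.trans (D≃D∂ p) (Pol.trans (D∂-cong p≃q) (Pol.sym (D≃D∂ q)))
  ; δ-+     = λ p q → Pol.reflexive (D-++ p q)
  ; leibniz = leibniz
  }
  where
  leibniz : ∀ p q → D (p *P q) ≃ (D p *P q) +P (p *P D q)
  leibniz p q = begin
    D (p *P q)
      ≈⟨ D≃D∂ (p *P q) ⟩
    D∂ (p *P q)
      ≈⟨ Pol.+-cong (Pol.*-congˡ {rule X} (∂-leibniz X p q)) (Pol.+-cong (Pol.*-congˡ {rule Y} (∂-leibniz Y p q))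
           (Pol.+-cong (Pol.*-congˡ {rule Z} (∂-leibniz Z p q)) (Pol.*-congˡ {rule W} (∂-leibniz W p q)))) ⟩
    (rule X *P ((∂ X p *P q) +P (p *P ∂ X q))) +P ((rule Y *P ((∂ Y p *P q) +P (p *P ∂ Y q)))
      +P ((rule Z *P ((∂ Z p *P q) +P (p *P ∂ Z q))) +P (rule W *P ((∂ W p *P q) +P (p *P ∂ W q)))))
      ≈⟨ solve 14 (λ gx gy gz gw ax ay az aw bx by bz bw p q →
              gx :* (ax :* q :+ p :* bx) :+ (gy :* (ay :* q :+ p :* by) :+ (gz :* (az :* q :+ p :* bz) :+ gw :* (aw :* q :+ p :* bw)))
           := (gx :* ax :+ (gy :* ay :+ (gz :* az :+ gw :* aw))) :* q :+ p :* (gx :* bx :+ (gy :* by :+ (gz :* bz :+ gw :* bw))))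
           Pol.refl (rule X) (rule Y) (rule Z) (rule W) (∂ X p) (∂ Y p) (∂ Z p) (∂ W p) (∂ X q) (∂ Y q) (∂ Z q) (∂ W q) p q ⟩
    (D∂ p *P q) +P (p *P D∂ q)
      ≈⟨ Pol.+-cong (Pol.*-congʳ {q} (D≃D∂ p)) (Pol.*-congˡ {p} (D≃D∂ q)) ⟨
    (D p *P q) +P (p *P D q) ∎
    where
    open import Relation.Binary.Reasoning.Setoid Pol.setoid
    open Pol-Solver using (solve; _:=_; _:+_; _:*_)

zero-term : ∀ m′ p → ((0ℚ , m′) ∷ p) ≃ p
zero-term m′ p = coeffwise λ m → trans (coeff-∷ 0ℚ m′ p m) (trans (cong (ℚ._+ coeff p m) (term-coeff-0 m′ m)) (ℚ.+-identityˡ (coeff p m)))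

D-cst : ∀ c → D (cst c) ≃ 0P
D-cst c = vanishes (c ℚ.* ℕ→ℚ 0) (ℚ.*-zeroʳ c)
  where
  vanishes : ∀ k → k ≡ 0ℚ → ∀ {m₁ m₂ m₃ m₄} → ((k , m₁) ∷ (k , m₂) ∷ (k , m₃) ∷ (k , m₄) ∷ []) ≃ []
  vanishes _ refl = Pol.trans (zero-term _ _) (Pol.trans (zero-term _ _) (Pol.trans (zero-term _ _) (zero-term _ [])))

D-varx : D varx ≃ (varx *P vary)
D-varx = Pol.+-cong Pol.refl (Pol.trans (zero-term _ _) (Pol.trans (zero-term _ _) (zero-term _ [])))

D-vary : D vary ≃ (varx *P varz)
D-vary = Pol.trans (zero-term _ _) (Pol.+-cong Pol.refl (Pol.trans (zero-term _ _) (zero-term _ [])))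

D-varz : D varz ≃ (varz *P varw)
D-varz = Pol.trans (zero-term _ _) (Pol.trans (zero-term _ _) (Pol.+-cong Pol.refl (zero-term _ [])))

D-varw : D varw ≃ (varx *P varz)
D-varw = Pol.trans (zero-term _ _) (Pol.trans (zero-term _ _) (zero-term _ _))


D-Δ² : D Δ² ≃ 0P
D-Δ² = Grammar.δ-discriminant Pol-ring cst-morphism D-isDerivation D-cst varx vary varz varw D-varx D-vary D-varz D-varw

module Pol[Δ] = Adjoin√ Pol-ring Δ²
open Pol[Δ] using (_≋_; _&_)

R-ring : CommutativeRing 0ℓ 0ℓ
R-ring = Pol[Δ].commutativeRing

module R = CommutativeRing R-ring
module ι-hom = _-Raw-AlmostCommutative⟶_ Pol[Δ].ι-morphism

R-from-ℚ : ℚ.+-*-rawRing -Raw-AlmostCommutative⟶ fromCommutativeRing R-ring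
R-from-ℚ = Pol[Δ].lift-ℚ cst-morphism

DR : R → R
DR (a , b) = (D a , D b)

DR-isDerivation : IsDerivation R-ring DR
DR-isDerivation = Pol[Δ].lift-derivation D-isDerivation D-Δ²

DR-cst : ∀ c → DR (ι (cst c)) ≋ 0R
DR-cst c = D-cst c & Pol.refl

DR-Δ : DR Δ ≋ 0R
DR-Δ = Pol.refl & D-cst 1ℚ

DR-ι : ∀ p q r → D p ≃ (q *P r) → DR (ι p) ≋ (ι q *R ι r)
DR-ι p q r Dp≃qr = R.trans (Pol[Δ].ι-cong Dp≃qr) (ι-hom.*-homo q r)

module GrammarR = Grammar R-ring R-from-ℚ DR-isDerivation DR-cst (ι varx) yR zR wR
  (DR-ι varx varx vary D-varx) (DR-ι vary varx varz D-vary) (DR-ι varz varz varw D-varz) (DR-ι varw varx varz D-varw)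

Δ*Δ : Δ *R Δ ≋ GrammarR.discriminant
Δ*Δ = begin
  Δ *R Δ
    ≈⟨ Pol[Δ].√d*√d ⟩
  ι (((varw +P vary) *P (varw +P vary)) +P (-P (c₄ *P (varx *P varz))))
    ≈⟨ ι-hom.+-homo ((varw +P vary) *P (varw +P vary)) (-P (c₄ *P (varx *P varz))) ⟩
  ι ((varw +P vary) *P (varw +P vary)) +R ι (-P (c₄ *P (varx *P varz)))
    ≈⟨ R.+-cong (R.trans (ι-hom.*-homo (varw +P vary) (varw +P vary)) (R.*-cong (ι-hom.+-homo varw vary) (ι-hom.+-homo varw vary)))
                (R.trans (ι-hom.-‿homo (c₄ *P (varx *P varz)))
                         (R.-‿cong (R.trans (ι-hom.*-homo c₄ (varx *P varz)) (R.*-congˡ {ι c₄} (ι-hom.*-homo varx varz))))) ⟩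
  ((wR +R yR) *R (wR +R yR)) +R (-R (ι c₄ *R (ι varx *R zR))) ∎
  where
  open import Relation.Binary.Reasoning.Setoid R.setoid
  c₄ : Pol
  c₄ = cst (ℕ→ℚ 4)

module EGF = ExponentialSeries R-ring R-from-ℚ

ΣR≡sum : ∀ n g → ΣR n g ≡ EGF.sum n g
ΣR≡sum zero    g = refl
ΣR≡sum (suc n) g = cong (_+R g (suc n)) (ΣR≡sum n g)

⋆≋EGF-⋆ : ∀ f {f′} g {g′} → (∀ j → f j ≋ f′ j) → (∀ j → g j ≋ g′ j) → ∀ n → (f ⋆ g) n ≋ (f′ EGF.⋆ g′) n
⋆≋EGF-⋆ f {f′} g f≋f′ g≋g′ n = R.trans (R.reflexive (ΣR≡sum n _)) (R.trans (EGF.⋆-congˡ g n f≋f′) (EGF.⋆-congʳ f′ n g≋g′))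

const≋constant : ∀ u n → const u n ≋ EGF.constant u n
const≋constant u zero    = R.refl
const≋constant u (suc n) = R.refl

expS≋exp : ∀ u n → expS u n ≋ EGF.exp u n
expS≋exp u zero    = R.refl
expS≋exp u (suc n) = R.*-congˡ {u} (expS≋exp u n)

≋⇒≈R : ∀ u v → u ≋ v → u ≈R v
≋⇒≈R u v (p & q) = coeff-≡ p , coeff-≡ q

theorem3p1 : (Gen varz ⋆ denS) ≈S numS
theorem3p1 n = ≋⇒≈R ((Gen varz ⋆ denS) n) (numS n) (begin
    (Gen varz ⋆ denS) n
      ≈⟨ ⋆≋EGF-⋆ (Gen varz) denS (λ _ → R.refl) denS≋den n ⟩
    (Gen varz EGF.⋆ den) n
      ≈⟨ GrammarR.generating-function Δ DR-Δ Δ*Δ (Gen varz) R.refl (λ _ → R.refl) n ⟩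
    (EGF.constant K EGF.⋆ EGF.exp α) n
      ≈⟨ ⋆≋EGF-⋆ (const K) (expS α) (const≋constant K) (expS≋exp α) n ⟨
    numS n ∎)
  where
  open import Relation.Binary.Reasoning.Setoid R.setoid
  a b K α : R
  a = (wR +R yR) +R Δ
  b = (wR +R yR) -R Δ
  K = ℕ→R 2 *R (zR *R Δ)
  α = ½R *R ((wR -R yR) +R Δ)
  den : ℕ → R
  den = EGF.constant a EGF.⊖ EGF.constant b EGF.⋆ EGF.exp Δ
  denS≋den : ∀ j → denS j ≋ den j
  denS≋den j = R.+-cong (const≋constant a j) (R.-‿cong (⋆≋EGF-⋆ (const b) (expS Δ) (const≋constant b) (expS≋exp Δ) j))
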